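{- Let $\triangle$ be a triangle of a Random Apollonian Network containing $m$ faces, and let $Z_1,\dots,Z_9$ be the numbers of faces inside the $9$ triangles of the standard $2$-subdivision of $\triangle$. For every $\varepsilon>0$ there exists $m_0=m_0(\varepsilon)$ such that for all $m>m_0$, $$\mathbb{P}\Big(\min\{Z_1,\dots,Z_9\}/m<\varepsilon\Big) < 13\,\varepsilon^{1/4}.$$
   Context: A Random Apollonian Network (RAN) is built as follows: start with a triangle embedded in the plane; in each step choose a bounded face uniformly at random (independently of previous choices), add a new vertex inside it and join it to the three vertices of that face ("subdividing" the face). "Faces" means bounded faces. A triangle of the RAN is any triangle that was a face at some stage of the process; the faces inside it are the final faces lying in its interior (the subgraph on and inside a triangle containing $m$ faces is distributed as a RAN with $m$ faces). The standard 1-subdivision of a triangle is the set of three triangles obtained by subdividing it once; the standard $k$-subdivision ($k>1$) is obtained by subdividing once each triangle of the standard $(k-1)$-subdivision. So the standard 2-subdivision consists of 9 triangles.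
   Formalization: The parameter ε ranges over the positive rationals. -}

module Defs where

open import Data.Nat as ℕ using (ℕ; zero; suc; _+_; _⊓_)
open import Data.Nat.Properties using (+-comm)
open import Data.Fin using (Fin; splitAt)
open import Data.Sum using (inj₁; inj₂)
open import Data.Integer using (+_)
open import Data.Rational using (ℚ; 0ℚ; 1ℚ; _/_; _<_; _<?_; _*_)
import Data.Rational as Q
open import Relation.Nullary using (does)
open import Data.Bool using (Bool; if_then_else_)

-- The recursive structure of a RAN: a triangle is either a final face
-- (leaf) or has been subdivided into three triangles (node).
data Tri : Set where
  face : Tri
  node : Tri → Tri → Tri → Tri

faces : Tri → ℕ
faces face = 1
faces (node a b c) = (faces a + faces b) + faces c

faces-nonZero : ∀ t → ℕ.NonZero (faces t)
faces-nonZero face = _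
faces-nonZero (node a b c) = go (faces-nonZero a)
  where
  go : ℕ.NonZero (faces a) → ℕ.NonZero ((faces a + faces b) + faces c)
  go nz with faces a
  ... | suc _ = _

-- subdivide the i-th face (faces enumerated left to right)
subdivide : (t : Tri) → Fin (faces t) → Tri
subdivide face _ = node face face face
subdivide (node a b c) i with splitAt (faces a + faces b) i
... | inj₂ k = node a b (subdivide c k)
... | inj₁ j with splitAt (faces a) j
...   | inj₁ x = node (subdivide a x) b c
...   | inj₂ y = node a (subdivide b y) c

sumFin : (k : ℕ) → (Fin k → ℚ) → ℚ
sumFin zero f = 0ℚ
sumFin (suc k) f = f Fin.zero Q.+ sumFin k (λ i → f (Fin.suc i))
  where import Data.Fin as Fin

-- Probability that, starting from triangulation t and performing n further
-- steps (each step subdividing a uniformly random face, independently),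
-- the final triangulation satisfies the (decidable) event P.
prob : ℕ → Tri → (Tri → Bool) → ℚ
prob zero t P = if P t then 1ℚ else 0ℚ
prob (suc n) t P =
  ((+ 1) / faces t) {{faces-nonZero t}} * sumFin (faces t) (λ i → prob n (subdivide t i) P)

-- RAN after n steps (from a single triangle): 2n+1 faces.
ranProb : ℕ → (Tri → Bool) → ℚ
ranProb n P = prob n face P

-- faces inside the three triangles of the standard 1-subdivision of a
-- child; 0 if that triangle was never subdivided (so those triangles do
-- not exist in the RAN).
sub3 : Tri → ℕ
sub3 face = 0
sub3 (node a b c) = (faces a ⊓ faces b) ⊓ faces c

-- min {Z_1,…,Z_9} over the standard 2-subdivision of the root triangle
-- (0 if some triangle of the standard 2-subdivision does not exist).
minZ : Tri → ℕ
minZ face = 0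
minZ (node a b c) = (sub3 a ⊓ sub3 b) ⊓ sub3 c

smallEvent : ℚ → Tri → Bool
smallEvent ε t = does ((((+ minZ t) / faces t) {{faces-nonZero t}}) <? ε)

module Submission where

-- Corollary 5: in a RAN with m faces, P(min{Z₁,…,Z₉}/m < ε) < 13 ε^{1/4}
-- for m large, stated as P⁴ < 13⁴ ε = 28561 ε.
--
-- Everything is reduced to counting.  All histories of a RAN are equally
-- likely, so a probability is a number of histories divided by the number
-- of all histories (Histories, RationalCounting).  Grouping histories by
-- the number of steps falling inside one child of the root
-- (ChildDecomposition) yields closed forms showing that a child ends with
-- at most the fraction x of the faces with probability at most ≈ √x
-- (ChildTail).  For ε = p/q and a ≈ √(pq), a small triangle of the
-- standard 2-subdivision forces one of 12 events: a child holding less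
-- than the fraction a/q ≈ √ε, or a grandchild holding less than the
-- fraction p/a ≈ √ε of its parent (Covering).  Each has probability at most
-- √(1.1·√ε) (EventBounds, with the square-root calculus of SquareBounds);
-- adding the twelve bounds gives the fourth-power inequality, first for
-- counts (CountingForm) and then for probabilities in ℚ.

open import Defs

-- A history of length n from a triangulation
-- t is a sequence of n face choices; from a triangulation with F faces
-- there are  F (F+2) ⋯ (F+2n-2)  of them, all equally likely, so
-- probabilities are ratios of natural-number counts.
module Histories where

  open import Data.Nat using (ℕ; zero; suc; _+_; _*_; _≤_; z≤n)
  open import Data.Nat.Properties
  open import Data.Fin using (Fin; _↑ˡ_; _↑ʳ_; splitAt)
  import Data.Fin as Fin using (zero; suc)
  open import Data.Fin.Properties using (splitAt-↑ˡ; splitAt-↑ʳ)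
  open import Data.Sum using (inj₁; inj₂)
  open import Data.Nat.Tactic.RingSolver using (solve-∀)
  open import Relation.Binary.PropositionalEquality
  open ≡-Reasoning
  open import Algebra.Properties.Semiring.Sum +-*-semiring public
    using (sum; sum-cong-≗; ∑-distrib-+; *-distribˡ-sum)

  sum-mono : ∀ {k} {f g : Fin k → ℕ} → (∀ i → f i ≤ g i) → sum f ≤ sum g
  sum-mono {zero}  f≤g = z≤n
  sum-mono {suc k} f≤g = +-mono-≤ (f≤g Fin.zero) (sum-mono (λ i → f≤g (Fin.suc i)))

  sum-const : ∀ k c → sum {k} (λ _ → c) ≡ k * c
  sum-const zero    c = refl
  sum-const (suc k) c = cong (c +_) (sum-const k c)

  sum-split : ∀ m n (f : Fin (m + n) → ℕ) →
              sum f ≡ sum (λ i → f (i ↑ˡ n)) + sum (λ j → f (m ↑ʳ j))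
  sum-split zero    n f = refl
  sum-split (suc m) n f =
    trans (cong (f Fin.zero +_) (sum-split m n (λ i → f (Fin.suc i))))
          (sym (+-assoc (f Fin.zero) _ _))

  subdivide-first : ∀ a b c x →
    subdivide (node a b c) ((x ↑ˡ faces b) ↑ˡ faces c) ≡ node (subdivide a x) b c
  subdivide-first a b c x
    rewrite splitAt-↑ˡ (faces a + faces b) (x ↑ˡ faces b) (faces c)
          | splitAt-↑ˡ (faces a) x (faces b) = refl

  subdivide-second : ∀ a b c y →
    subdivide (node a b c) ((faces a ↑ʳ y) ↑ˡ faces c) ≡ node a (subdivide b y) c
  subdivide-second a b c y
    rewrite splitAt-↑ˡ (faces a + faces b) (faces a ↑ʳ y) (faces c)
          | splitAt-↑ʳ (faces a) (faces b) y = refl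

  subdivide-third : ∀ a b c z →
    subdivide (node a b c) ((faces a + faces b) ↑ʳ z) ≡ node a b (subdivide c z)
  subdivide-third a b c z rewrite splitAt-↑ʳ (faces a + faces b) (faces c) z = refl

  sum-subdivide-node : ∀ a b c (g : Tri → ℕ) →
    sum (λ i → g (subdivide (node a b c) i)) ≡
      (sum (λ x → g (node (subdivide a x) b c)) + sum (λ y → g (node a (subdivide b y) c)))
      + sum (λ z → g (node a b (subdivide c z)))
  sum-subdivide-node a b c g = begin
    sum (λ i → g (subdivide (node a b c) i))
      ≡⟨ sum-split (faces a + faces b) (faces c) _ ⟩
    sum (λ i → g (subdivide (node a b c) (i ↑ˡ faces c)))
      + sum (λ z → g (subdivide (node a b c) ((faces a + faces b) ↑ʳ z)))
      ≡⟨ cong₂ _+_ (sum-split (faces a) (faces b) _)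
                   (sum-cong-≗ (λ z → cong g (subdivide-third a b c z))) ⟩
    (sum (λ x → g (subdivide (node a b c) ((x ↑ˡ faces b) ↑ˡ faces c)))
      + sum (λ y → g (subdivide (node a b c) ((faces a ↑ʳ y) ↑ˡ faces c))))
      + sum (λ z → g (node a b (subdivide c z)))
      ≡⟨ cong (_+ sum (λ z → g (node a b (subdivide c z))))
              (cong₂ _+_ (sum-cong-≗ (λ x → cong g (subdivide-first a b c x)))
                         (sum-cong-≗ (λ y → cong g (subdivide-second a b c y)))) ⟩
    (sum (λ x → g (node (subdivide a x) b c)) + sum (λ y → g (node a (subdivide b y) c)))
      + sum (λ z → g (node a b (subdivide c z))) ∎

  faces-subdivide : ∀ t i → faces (subdivide t i) ≡ faces t + 2
  faces-subdivide face i = refl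
  faces-subdivide (node a b c) i with splitAt (faces a + faces b) i
  ... | inj₂ z rewrite faces-subdivide c z = sym (+-assoc (faces a + faces b) (faces c) 2)
  ... | inj₁ j with splitAt (faces a) j
  ...   | inj₁ x rewrite faces-subdivide a x = shift-first (faces a) (faces b) (faces c)
    where shift-first : ∀ a b c → ((a + 2) + b) + c ≡ (a + b + c) + 2
          shift-first = solve-∀
  ...   | inj₂ y rewrite faces-subdivide b y = shift-second (faces a) (faces b) (faces c)
    where shift-second : ∀ a b c → (a + (b + 2)) + c ≡ (a + b + c) + 2
          shift-second = solve-∀

  histSum : ℕ → Tri → (Tri → ℕ) → ℕ
  histSum zero    t f = f t
  histSum (suc n) t f = sum (λ i → histSum n (subdivide t i) f)

  histories : ℕ → ℕ → ℕ
  histories F zero    = 1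
  histories F (suc n) = F * histories (F + 2) n

  histSum-cong : ∀ n t {f g : Tri → ℕ} → (∀ s → f s ≡ g s) → histSum n t f ≡ histSum n t g
  histSum-cong zero    t f≗g = f≗g t
  histSum-cong (suc n) t f≗g = sum-cong-≗ (λ i → histSum-cong n (subdivide t i) f≗g)

  histSum-+ : ∀ n t f g → histSum n t (λ s → f s + g s) ≡ histSum n t f + histSum n t g
  histSum-+ zero    t f g = refl
  histSum-+ (suc n) t f g =
    trans (sum-cong-≗ (λ i → histSum-+ n (subdivide t i) f g))
          (∑-distrib-+ (λ i → histSum n (subdivide t i) f) (λ i → histSum n (subdivide t i) g))

  histSum-mono : ∀ n t f g → (∀ s → faces s ≡ faces t + 2 * n → f s ≤ g s) →
                 histSum n t f ≤ histSum n t g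
  histSum-mono zero    t f g f≤g = f≤g t (sym (+-identityʳ _))
  histSum-mono (suc n) t f g f≤g = sum-mono (λ i →
    histSum-mono n (subdivide t i) f g (λ s eq → f≤g s (trans eq (size i))))
    where
    shift : ∀ F n → F + 2 + 2 * n ≡ F + 2 * suc n
    shift = solve-∀
    size : ∀ i → faces (subdivide t i) + 2 * n ≡ faces t + 2 * suc n
    size i = trans (cong (_+ 2 * n) (faces-subdivide t i)) (shift (faces t) n)

  histSum-const : ∀ n t c → histSum n t (λ _ → c) ≡ c * histories (faces t) n
  histSum-const zero    t c = sym (*-identityʳ c)
  histSum-const (suc n) t c = begin
    sum (λ i → histSum n (subdivide t i) (λ _ → c))
      ≡⟨ sum-cong-≗ {faces t} (λ i → trans (histSum-const n (subdivide t i) c)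
                                  (cong (λ F → c * histories F n) (faces-subdivide t i))) ⟩
    sum {faces t} (λ _ → c * histories (faces t + 2) n)
      ≡⟨ sum-const (faces t) _ ⟩
    faces t * (c * histories (faces t + 2) n)
      ≡⟨ x*[y*z]≡y*[x*z] (faces t) c (histories (faces t + 2) n) ⟩
    c * (faces t * histories (faces t + 2) n) ∎
    where x*[y*z]≡y*[x*z] : ∀ x y z → x * (y * z) ≡ y * (x * z)
          x*[y*z]≡y*[x*z] = solve-∀

  histSum-bound : ∀ n t f c → (∀ s → faces s ≡ faces t + 2 * n → f s ≤ c) →
                  histSum n t f ≤ c * histories (faces t) n
  histSum-bound n t f c f≤c =
    subst (histSum n t f ≤_) (histSum-const n t c) (histSum-mono n t f (λ _ → c) f≤c)

-- In a history from  node a b c  each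
-- step falls either inside the distinguished child or among the other
-- faces; grouping histories by the number i of steps inside the child
-- expresses any sum over the child's final state as an antidiagonal sum
-- Σ_{i+j=n} interleavings B i j · histSum i a f.
module ChildDecomposition where

  open Histories
  open import Data.Nat using (ℕ; zero; suc; _+_; _*_; _≤_)
  open import Data.Nat.Properties
  open import Data.Fin using (Fin)
  import Data.Fin as Fin using (zero; suc)
  open import Data.Nat.Tactic.RingSolver using (solve-∀)
  open import Relation.Binary.PropositionalEquality
  open ≡-Reasoning

  -- diagSum n F = Σ_{i+j=n} F i j
  diagSum : ℕ → (ℕ → ℕ → ℕ) → ℕ
  diagSum zero    F = F 0 0
  diagSum (suc n) F = F 0 (suc n) + diagSum n (λ i j → F (suc i) j)

  diagSum-cong : ∀ n {F G} → (∀ i j → F i j ≡ G i j) → diagSum n F ≡ diagSum n G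
  diagSum-cong zero    F≗G = F≗G 0 0
  diagSum-cong (suc n) F≗G = cong₂ _+_ (F≗G 0 (suc n)) (diagSum-cong n (λ i → F≗G (suc i)))

  diagSum-mono : ∀ n {F G} → (∀ i j → F i j ≤ G i j) → diagSum n F ≤ diagSum n G
  diagSum-mono zero    F≤G = F≤G 0 0
  diagSum-mono (suc n) F≤G = +-mono-≤ (F≤G 0 (suc n)) (diagSum-mono n (λ i → F≤G (suc i)))

  diagSum-+ : ∀ n F G → diagSum n (λ i j → F i j + G i j) ≡ diagSum n F + diagSum n G
  diagSum-+ zero    F G = refl
  diagSum-+ (suc n) F G rewrite diagSum-+ n (λ i → F (suc i)) (λ i → G (suc i)) =
    +-+-swap (F 0 (suc n)) (G 0 (suc n)) _ _
    where +-+-swap : ∀ a b c d → (a + b) + (c + d) ≡ (a + c) + (b + d)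
          +-+-swap = solve-∀

  diagSum-* : ∀ n c F → diagSum n (λ i j → c * F i j) ≡ c * diagSum n F
  diagSum-* zero    c F = refl
  diagSum-* (suc n) c F rewrite diagSum-* n c (λ i → F (suc i)) = sym (*-distribˡ-+ c _ _)

  diagSum-zero : ∀ n → diagSum n (λ _ _ → 0) ≡ 0
  diagSum-zero zero    = refl
  diagSum-zero (suc n) = diagSum-zero n

  diagSum-sum : ∀ {k} n (G : Fin k → ℕ → ℕ → ℕ) →
                sum (λ x → diagSum n (G x)) ≡ diagSum n (λ i j → sum (λ x → G x i j))
  diagSum-sum {zero}  n G = sym (diagSum-zero n)
  diagSum-sum {suc k} n G rewrite diagSum-sum n (λ x → G (Fin.suc x)) =
    sym (diagSum-+ n (G Fin.zero) _)

  diagSum-dropˡ : ∀ n F → F 0 (suc n) ≡ 0 → diagSum (suc n) F ≡ diagSum n (λ i j → F (suc i) j)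
  diagSum-dropˡ n F F0≡0 = cong (_+ diagSum n (λ i j → F (suc i) j)) F0≡0

  diagSum-dropʳ : ∀ n F → F (suc n) 0 ≡ 0 → diagSum (suc n) F ≡ diagSum n (λ i j → F i (suc j))
  diagSum-dropʳ zero    F F0≡0 = trans (cong (F 0 1 +_) F0≡0) (+-identityʳ _)
  diagSum-dropʳ (suc n) F F0≡0 =
    cong (F 0 (suc (suc n)) +_) (diagSum-dropʳ n (λ i j → F (suc i) j) F0≡0)

  -- interleavings B i j: the number of ways to perform i steps inside a
  -- distinguished child and j steps among the other faces, initially B of
  -- them and two more after each such step (the child's own choices are
  -- counted separately)
  interleavings : ℕ → ℕ → ℕ → ℕ
  interleavings B zero    zero    = 1
  interleavings B (suc i) zero    = interleavings B i zero
  interleavings B zero    (suc j) = B * interleavings (B + 2) zero j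
  interleavings B (suc i) (suc j) = interleavings B i (suc j) + B * interleavings (B + 2) (suc i) j

  -- Conditioning on where the first step falls: one recursion step of the
  -- weighted antidiagonal sum.
  diagSum-interleavings : ∀ n B (H : ℕ → ℕ) →
    diagSum (suc n) (λ i j → interleavings B i j * H i) ≡
      diagSum n (λ i j → interleavings B i j * H (suc i))
      + B * diagSum n (λ i j → interleavings (B + 2) i j * H i)
  diagSum-interleavings n B H = begin
    diagSum (suc n) (λ i j → interleavings B i j * H i)
      ≡⟨ diagSum-cong (suc n) split ⟩
    diagSum (suc n) (λ i j → inChild i j + outside i j)
      ≡⟨ diagSum-+ (suc n) inChild outside ⟩
    diagSum (suc n) inChild + diagSum (suc n) outside
      ≡⟨ cong₂ _+_ (diagSum-dropˡ n inChild refl) (diagSum-dropʳ n outside refl) ⟩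
    diagSum n (λ i j → interleavings B i j * H (suc i))
      + diagSum n (λ i j → B * (interleavings (B + 2) i j * H i))
      ≡⟨ cong (diagSum n (λ i j → interleavings B i j * H (suc i)) +_) (diagSum-* n B _) ⟩
    diagSum n (λ i j → interleavings B i j * H (suc i))
      + B * diagSum n (λ i j → interleavings (B + 2) i j * H i) ∎
    where
    inChild outside : ℕ → ℕ → ℕ
    inChild zero    zero    = H 0
    inChild zero    (suc j) = 0
    inChild (suc i) j       = interleavings B i j * H (suc i)
    outside i zero    = 0
    outside i (suc j) = B * (interleavings (B + 2) i j * H i)
    split : ∀ i j → interleavings B i j * H i ≡ inChild i j + outside i j
    split zero    zero    = trans (*-identityˡ (H 0)) (sym (+-identityʳ (H 0)))
    split zero    (suc j) = *-assoc B _ (H 0)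
    split (suc i) zero    = sym (+-identityʳ _)
    split (suc i) (suc j) =
      trans (*-distribʳ-+ (H (suc i)) (interleavings B i (suc j)) _)
            (cong (interleavings B i (suc j) * H (suc i) +_) (*-assoc B _ _))

  -- the three children of a subdivided triangle (a face is its own child)
  data Pos : Set where
    first second third : Pos

  child : Pos → Tri → Tri
  child _      face         = face
  child first  (node a b c) = a
  child second (node a b c) = b
  child third  (node a b c) = c

  Σpos : (Pos → ℕ) → ℕ
  Σpos h = (h first + h second) + h third

  Σpos-cong : ∀ {x y : Pos → ℕ} → (∀ π → x π ≡ y π) → Σpos x ≡ Σpos y
  Σpos-cong x≗y = cong₂ _+_ (cong₂ _+_ (x≗y first) (x≗y second)) (x≗y third)

  Σpos-+ : ∀ (x y : Pos → ℕ) → Σpos (λ π → x π + y π) ≡ Σpos x + Σpos y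
  Σpos-+ x y = interchange (x first) (x second) (x third) (y first) (y second) (y third)
    where interchange : ∀ a b c d e f → ((a + d) + (b + e)) + (c + f) ≡ ((a + b) + c) + ((d + e) + f)
          interchange = solve-∀

  histSum-Σpos : ∀ n t (h : Pos → Tri → ℕ) →
                 histSum n t (λ s → Σpos (λ π → h π s)) ≡ Σpos (λ π → histSum n t (h π))
  histSum-Σpos n t h =
    trans (histSum-+ n t _ (h third))
          (cong (_+ histSum n t (h third)) (histSum-+ n t (h first) (h second)))

  histSum-first : ∀ n a b c f →
    histSum n (node a b c) (λ t → f (child first t)) ≡
      diagSum n (λ i j → interleavings (faces b + faces c) i j * histSum i a f)
  histSum-first zero    a b c f = sym (+-identityʳ _)
  histSum-first (suc n) a b c f = begin
    sum (λ i → histSum n (subdivide (node a b c) i) g)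
      ≡⟨ sum-subdivide-node a b c (λ s → histSum n s g) ⟩
    (sum (λ x → histSum n (node (subdivide a x) b c) g)
      + sum (λ y → histSum n (node a (subdivide b y) c) g))
      + sum (λ z → histSum n (node a b (subdivide c z)) g)
      ≡⟨ cong₂ _+_ (cong₂ _+_ stepInside
                     (stepOutside (λ y → subdivide b y) (λ _ → c) λ y →
                        trans (cong (_+ faces c) (faces-subdivide b y)) (+-shift (faces b) (faces c))))
                   (stepOutside (λ _ → b) (λ z → subdivide c z) λ z →
                        trans (cong (faces b +_) (faces-subdivide c z)) (sym (+-assoc (faces b) (faces c) 2))) ⟩
    (diagSum n (λ i j → interleavings B i j * histSum (suc i) a f) + faces b * rest)
      + faces c * rest
      ≡⟨ regroup (diagSum n (λ i j → interleavings B i j * histSum (suc i) a f)) (faces b) (faces c) rest ⟩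
    diagSum n (λ i j → interleavings B i j * histSum (suc i) a f) + B * rest
      ≡⟨ sym (diagSum-interleavings n B (λ i → histSum i a f)) ⟩
    diagSum (suc n) (λ i j → interleavings B i j * histSum i a f) ∎
    where
    g : Tri → ℕ
    g t = f (child first t)
    B = faces b + faces c
    rest = diagSum n (λ i j → interleavings (B + 2) i j * histSum i a f)
    +-shift : ∀ x y → x + 2 + y ≡ x + y + 2
    +-shift = solve-∀
    regroup : ∀ x u v w → (x + u * w) + v * w ≡ x + (u + v) * w
    regroup = solve-∀
    -- a first step inside the child: one more step of the child itself
    stepInside : sum (λ x → histSum n (node (subdivide a x) b c) g) ≡
                 diagSum n (λ i j → interleavings B i j * histSum (suc i) a f)
    stepInside = begin
      sum (λ x → histSum n (node (subdivide a x) b c) g)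
        ≡⟨ sum-cong-≗ (λ x → histSum-first n (subdivide a x) b c f) ⟩
      sum (λ x → diagSum n (λ i j → interleavings B i j * histSum i (subdivide a x) f))
        ≡⟨ diagSum-sum {faces a} n _ ⟩
      diagSum n (λ i j → sum (λ x → interleavings B i j * histSum i (subdivide a x) f))
        ≡⟨ diagSum-cong n (λ i j → sym (*-distribˡ-sum {faces a} (interleavings B i j) _)) ⟩
      diagSum n (λ i j → interleavings B i j * histSum (suc i) a f) ∎
    -- a first step elsewhere: the other faces now number B + 2
    stepOutside : ∀ {k} (b′ c′ : Fin k → Tri) → (∀ y → faces (b′ y) + faces (c′ y) ≡ B + 2) →
                  sum (λ y → histSum n (node a (b′ y) (c′ y)) g) ≡ k * rest
    stepOutside {k} b′ c′ size = trans
      (sum-cong-≗ (λ y → trans (histSum-first n a (b′ y) (c′ y) f)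
        (cong (λ F → diagSum n (λ i j → interleavings F i j * histSum i a f)) (size y))))
      (sum-const k rest)

  -- Relabelling the children of the root does not change history sums,
  -- which reduces the second and third children to the first.
  swap₁₂ swap₁₃ : Tri → Tri
  swap₁₂ face         = face
  swap₁₂ (node a b c) = node b a c
  swap₁₃ face         = face
  swap₁₃ (node a b c) = node c b a

  histSum-swap₁₂ : ∀ n a b c g →
    histSum n (node a b c) g ≡ histSum n (node b a c) (λ t → g (swap₁₂ t))
  histSum-swap₁₂ zero    a b c g = refl
  histSum-swap₁₂ (suc n) a b c g = begin
    histSum (suc n) (node a b c) g
      ≡⟨ sum-subdivide-node a b c (λ s → histSum n s g) ⟩
    (sum (λ x → histSum n (node (subdivide a x) b c) g)
      + sum (λ y → histSum n (node a (subdivide b y) c) g))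
      + sum (λ z → histSum n (node a b (subdivide c z)) g)
      ≡⟨ cong (_+ sum (λ z → histSum n (node a b (subdivide c z)) g))
              (+-comm (sum (λ x → histSum n (node (subdivide a x) b c) g))
                      (sum (λ y → histSum n (node a (subdivide b y) c) g))) ⟩
    (sum (λ y → histSum n (node a (subdivide b y) c) g)
      + sum (λ x → histSum n (node (subdivide a x) b c) g))
      + sum (λ z → histSum n (node a b (subdivide c z)) g)
      ≡⟨ cong₂ _+_ (cong₂ _+_ (sum-cong-≗ (λ y → histSum-swap₁₂ n a (subdivide b y) c g))
                              (sum-cong-≗ (λ x → histSum-swap₁₂ n (subdivide a x) b c g)))
                   (sum-cong-≗ (λ z → histSum-swap₁₂ n a b (subdivide c z) g)) ⟩
    (sum (λ y → histSum n (node (subdivide b y) a c) g′)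
      + sum (λ x → histSum n (node b (subdivide a x) c) g′))
      + sum (λ z → histSum n (node b a (subdivide c z)) g′)
      ≡⟨ sym (sum-subdivide-node b a c (λ s → histSum n s g′)) ⟩
    histSum (suc n) (node b a c) g′ ∎
    where g′ = λ t → g (swap₁₂ t)

  histSum-swap₁₃ : ∀ n a b c g →
    histSum n (node a b c) g ≡ histSum n (node c b a) (λ t → g (swap₁₃ t))
  histSum-swap₁₃ zero    a b c g = refl
  histSum-swap₁₃ (suc n) a b c g = begin
    histSum (suc n) (node a b c) g
      ≡⟨ sum-subdivide-node a b c (λ s → histSum n s g) ⟩
    (sum (λ x → histSum n (node (subdivide a x) b c) g)
      + sum (λ y → histSum n (node a (subdivide b y) c) g))
      + sum (λ z → histSum n (node a b (subdivide c z)) g)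
      ≡⟨ reverse (sum (λ x → histSum n (node (subdivide a x) b c) g))
                 (sum (λ y → histSum n (node a (subdivide b y) c) g))
                 (sum (λ z → histSum n (node a b (subdivide c z)) g)) ⟩
    (sum (λ z → histSum n (node a b (subdivide c z)) g)
      + sum (λ y → histSum n (node a (subdivide b y) c) g))
      + sum (λ x → histSum n (node (subdivide a x) b c) g)
      ≡⟨ cong₂ _+_ (cong₂ _+_ (sum-cong-≗ (λ z → histSum-swap₁₃ n a b (subdivide c z) g))
                              (sum-cong-≗ (λ y → histSum-swap₁₃ n a (subdivide b y) c g)))
                   (sum-cong-≗ (λ x → histSum-swap₁₃ n (subdivide a x) b c g)) ⟩
    (sum (λ z → histSum n (node (subdivide c z) b a) g′)
      + sum (λ y → histSum n (node c (subdivide b y) a) g′))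
      + sum (λ x → histSum n (node c b (subdivide a x)) g′)
      ≡⟨ sym (sum-subdivide-node c b a (λ s → histSum n s g′)) ⟩
    histSum (suc n) (node c b a) g′ ∎
    where
    g′ = λ t → g (swap₁₃ t)
    reverse : ∀ x y z → (x + y) + z ≡ (z + y) + x
    reverse = solve-∀

  -- the RAN after its first (forced) step
  ran₁ : Tri
  ran₁ = node face face face

  -- Each child of the root of ran₁ evolves as a RAN interleaved with the
  -- other two children, which start with 2 faces.
  histSum-child : ∀ π n f →
    histSum n ran₁ (λ t → f (child π t)) ≡
      diagSum n (λ i j → interleavings 2 i j * histSum i face f)
  histSum-child first  n f = histSum-first n face face face f
  histSum-child second n f = begin
    histSum n ran₁ (λ t → f (child second t))
      ≡⟨ histSum-swap₁₂ n face face face _ ⟩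
    histSum n ran₁ (λ t → f (child second (swap₁₂ t)))
      ≡⟨ histSum-cong n ran₁ (λ t → cong f (second∘swap₁₂ t)) ⟩
    histSum n ran₁ (λ t → f (child first t))
      ≡⟨ histSum-first n face face face f ⟩
    diagSum n (λ i j → interleavings 2 i j * histSum i face f) ∎
    where second∘swap₁₂ : ∀ t → child second (swap₁₂ t) ≡ child first t
          second∘swap₁₂ face         = refl
          second∘swap₁₂ (node a b c) = refl
  histSum-child third  n f = begin
    histSum n ran₁ (λ t → f (child third t))
      ≡⟨ histSum-swap₁₃ n face face face _ ⟩
    histSum n ran₁ (λ t → f (child third (swap₁₃ t)))
      ≡⟨ histSum-cong n ran₁ (λ t → cong f (third∘swap₁₃ t)) ⟩
    histSum n ran₁ (λ t → f (child first t))
      ≡⟨ histSum-first n face face face f ⟩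
    diagSum n (λ i j → interleavings 2 i j * histSum i face f) ∎
    where third∘swap₁₃ : ∀ t → child third (swap₁₃ t) ≡ child first t
          third∘swap₁₃ face         = refl
          third∘swap₁₃ (node a b c) = refl

-- Summing over the number i of steps taken inside
-- the first child gives closed forms in binomial coefficients and
-- factorials; from these, the probability that a child of the root has
-- received at most K of the n steps is at most  √((K+1)/(n+1)).
module ChildTail where

  open Histories
  open ChildDecomposition
  open import Data.Nat using (ℕ; zero; suc; _+_; _*_; _^_; _≤_; _<_; _∸_; z≤n; s≤s; _!; NonZero; >-nonZero)
  open import Data.Nat.Properties
  open import Data.Sum using (inj₁; inj₂)
  open import Data.Nat.Tactic.RingSolver using (solve-∀)
  open import Relation.Binary.PropositionalEquality
  open import Relation.Nullary using (yes; no; contradiction)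

  -- binom i j = (i+j choose i), by Pascal's rule
  binom : ℕ → ℕ → ℕ
  binom zero    j       = 1
  binom (suc i) zero    = 1
  binom (suc i) (suc j) = binom i (suc j) + binom (suc i) j

  binom-i0 : ∀ i → binom i 0 ≡ 1
  binom-i0 zero    = refl
  binom-i0 (suc i) = refl

  -- choose which steps go inside the child, then the choices outside it
  interleavings-closed : ∀ B i j → interleavings B i j ≡ binom i j * histories B j
  interleavings-closed B zero zero = refl
  interleavings-closed B (suc i) zero =
    trans (interleavings-closed B i zero) (cong (_* 1) (binom-i0 i))
  interleavings-closed B zero (suc j) =
    trans (cong (B *_) (trans (interleavings-closed (B + 2) zero j) (*-identityˡ _)))
          (sym (*-identityˡ _))
  interleavings-closed B (suc i) (suc j)
    rewrite interleavings-closed B i (suc j) | interleavings-closed (B + 2) (suc i) j =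
    pascal (binom i (suc j)) (binom (suc i) j) B (histories (B + 2) j)
    where pascal : ∀ x y b r → x * (b * r) + b * (y * r) ≡ (x + y) * (b * r)
          pascal = solve-∀

  binom-factorial : ∀ i j → binom i j * (i ! * j !) ≡ (i + j) !
  binom-factorial zero j = trans (*-identityˡ _) (*-identityˡ _)
  binom-factorial (suc i) zero =
    trans (*-identityˡ _) (trans (*-identityʳ _) (cong _! (sym (+-identityʳ (suc i)))))
  binom-factorial (suc i) (suc j) = begin
    (binom i (suc j) + binom (suc i) j) * ((suc i * i !) * (suc j * j !))
      ≡⟨ expand (binom i (suc j)) (binom (suc i) j) i j (i !) (j !) ⟩
    (binom i (suc j) * (i ! * (suc j * j !))) * suc i + (binom (suc i) j * ((suc i * i !) * j !)) * suc j
      ≡⟨ cong₂ (λ u v → u * suc i + v * suc j)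
               (trans (binom-factorial i (suc j)) (cong _! (+-suc i j))) (binom-factorial (suc i) j) ⟩
    (suc (i + j)) ! * suc i + (suc (i + j)) ! * suc j
      ≡⟨ collect ((suc (i + j)) !) i j ⟩
    suc (suc (i + j)) * (suc (i + j)) !
      ≡⟨ cong (λ m → suc m !) (sym (+-suc i j)) ⟩
    (suc i + suc j) ! ∎
    where
    open ≡-Reasoning
    expand : ∀ b₁ b₂ i j fi fj → (b₁ + b₂) * ((suc i * fi) * (suc j * fj)) ≡
             (b₁ * (fi * (suc j * fj))) * suc i + (b₂ * ((suc i * fi) * fj)) * suc j
    expand = solve-∀
    collect : ∀ y i j → y * suc i + y * suc j ≡ suc (suc (i + j)) * y
    collect = solve-∀

  binom-swap : ∀ K r → binom K (suc r) * suc r ≡ binom (suc K) r * suc K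
  binom-swap K r = *-cancelʳ-≡ _ _ (K ! * r !) {{K !* r !≢0}} (begin
    binom K (suc r) * suc r * (K ! * r !)   ≡⟨ absorb-r (binom K (suc r)) r (K !) (r !) ⟩
    binom K (suc r) * (K ! * (suc r) !)     ≡⟨ binom-factorial K (suc r) ⟩
    (K + suc r) !                           ≡⟨ cong _! (+-suc K r) ⟩
    (suc K + r) !                           ≡⟨ sym (binom-factorial (suc K) r) ⟩
    binom (suc K) r * ((suc K) ! * r !)     ≡⟨ sym (absorb-K (binom (suc K) r) K (K !) (r !)) ⟩
    binom (suc K) r * suc K * (K ! * r !) ∎)
    where
    open ≡-Reasoning
    absorb-r : ∀ b r fk fr → b * suc r * (fk * fr) ≡ b * (fk * (suc r * fr))
    absorb-r = solve-∀
    absorb-K : ∀ b k fk fr → b * suc k * (fk * fr) ≡ b * ((suc k * fk) * fr)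
    absorb-K = solve-∀

  histories-last : ∀ F k → histories F (suc k) ≡ histories F k * (F + 2 * k)
  histories-last F zero = last₀ F
    where last₀ : ∀ F → F * 1 ≡ 1 * (F + 2 * 0)
          last₀ = solve-∀
  histories-last F (suc k) rewrite histories-last (F + 2) k = lastₛ F (histories (F + 2) k) k
    where lastₛ : ∀ F r k → F * (r * (F + 2 + 2 * k)) ≡ F * r * (F + 2 * suc k)
          lastₛ = solve-∀

  histories-pos : ∀ F k → 0 < F → 0 < histories F k
  histories-pos F zero    0<F = s≤s z≤n
  histories-pos F (suc k) 0<F = *-mono-< 0<F (histories-pos (F + 2) k (≤-trans 0<F (m≤m+n F 2)))

  histories₂ : ∀ j → histories 2 j ≡ 2 ^ j * j !
  histories₂ zero = refl
  histories₂ (suc j) rewrite histories-last 2 j | histories₂ j = step (2 ^ j) (j !) j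
    where step : ∀ p f j → p * f * (2 + 2 * j) ≡ 2 * p * (suc j * f)
          step = solve-∀

  -- splitting the  K + r  steps of a 2-face start between two groups
  binom-histories₂ : ∀ K r → binom K r * histories 2 r * histories 2 K ≡ histories 2 (K + r)
  binom-histories₂ K r
    rewrite histories₂ r | histories₂ K | histories₂ (K + r) | ^-distribˡ-+-* 2 K r
          | sym (binom-factorial K r) =
    rearrange (binom K r) (2 ^ r) (2 ^ K) (r !) (K !)
    where rearrange : ∀ b pr pk fr fk → b * (pr * fr) * (pk * fk) ≡ pk * pr * (b * (fk * fr))
          rearrange = solve-∀

  -- diagSumUpTo K r F = Σ_{i ≤ K} F i (K + r - i): the part of an
  -- antidiagonal sum with at most K steps inside the child
  diagSumUpTo : ℕ → ℕ → (ℕ → ℕ → ℕ) → ℕ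
  diagSumUpTo zero    r F = F 0 r
  diagSumUpTo (suc K) r F = F 0 (suc K + r) + diagSumUpTo K r (λ i j → F (suc i) j)

  diagSumUpTo-last : ∀ K r F → diagSumUpTo (suc K) r F ≡ diagSumUpTo K (suc r) F + F (suc K) r
  diagSumUpTo-last zero    r F = refl
  diagSumUpTo-last (suc K) r F rewrite diagSumUpTo-last K r (λ i j → F (suc i) j) | +-suc K r =
    sym (+-assoc (F 0 (suc (suc (K + r)))) _ _)

  diagSum-truncate : ∀ K r F G → (∀ i j → i ≤ K → G i j ≡ F i j) → (∀ i j → K < i → G i j ≡ 0) →
                     diagSum (K + r) G ≡ diagSumUpTo K r F
  diagSum-truncate zero zero    F G G≡F G≡0 = G≡F 0 0 z≤n
  diagSum-truncate zero (suc r) F G G≡F G≡0 = begin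
    G 0 (suc r) + diagSum r (λ i j → G (suc i) j)
      ≡⟨ cong₂ _+_ (G≡F 0 (suc r) z≤n) (diagSum-cong r (λ i j → G≡0 (suc i) j (s≤s z≤n))) ⟩
    F 0 (suc r) + diagSum r (λ _ _ → 0)
      ≡⟨ cong (F 0 (suc r) +_) (diagSum-zero r) ⟩
    F 0 (suc r) + 0
      ≡⟨ +-identityʳ _ ⟩
    F 0 (suc r) ∎
    where open ≡-Reasoning
  diagSum-truncate (suc K) r F G G≡F G≡0 =
    cong₂ _+_ (G≡F 0 (suc K + r) z≤n)
              (diagSum-truncate K r (λ i j → F (suc i) j) (λ i j → G (suc i) j)
                 (λ i j i≤K → G≡F (suc i) j (s≤s i≤K)) (λ i j K<i → G≡0 (suc i) j (s≤s K<i)))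

  -- childWeight i j: histories from ran₁ with i steps in a given child
  -- and j elsewhere
  childWeight : ℕ → ℕ → ℕ
  childWeight i j = interleavings 2 i j * histories 1 i

  -- the number of histories of length K + r from ran₁ in which a given
  -- child takes at most K steps
  childAtMost-closed : ∀ K r → diagSumUpTo K r childWeight ≡ binom K r * histories 2 r * histories 3 K
  childAtMost-closed zero r =
    trans (*-identityʳ _) (trans (interleavings-closed 2 0 r) (sym (*-identityʳ _)))
  childAtMost-closed (suc K) r = begin
    diagSumUpTo (suc K) r childWeight
      ≡⟨ diagSumUpTo-last K r childWeight ⟩
    diagSumUpTo K (suc r) childWeight + childWeight (suc K) r
      ≡⟨ cong₂ _+_ (childAtMost-closed K (suc r))
                   (cong (_* histories 1 (suc K)) (interleavings-closed 2 (suc K) r)) ⟩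
    binom K (suc r) * histories 2 (suc r) * histories 3 K
      + binom (suc K) r * histories 2 r * (1 * histories 3 K)
      ≡⟨ cong (λ h → binom K (suc r) * h * histories 3 K + binom (suc K) r * histories 2 r * (1 * histories 3 K))
              (histories-last 2 r) ⟩
    binom K (suc r) * (histories 2 r * (2 + 2 * r)) * histories 3 K
      + binom (suc K) r * histories 2 r * (1 * histories 3 K)
      ≡⟨ cong (_+ binom (suc K) r * histories 2 r * (1 * histories 3 K))
              (trans (pull (binom K (suc r)) r (histories 2 r) (histories 3 K))
                     (cong (λ z → 2 * histories 2 r * histories 3 K * z) (binom-swap K r))) ⟩
    2 * histories 2 r * histories 3 K * (binom (suc K) r * suc K)
      + binom (suc K) r * histories 2 r * (1 * histories 3 K)
      ≡⟨ combine (binom (suc K) r) K (histories 2 r) (histories 3 K) ⟩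
    binom (suc K) r * histories 2 r * (histories 3 K * (3 + 2 * K))
      ≡⟨ cong (binom (suc K) r * histories 2 r *_) (sym (histories-last 3 K)) ⟩
    binom (suc K) r * histories 2 r * histories 3 (suc K) ∎
    where
    open ≡-Reasoning
    pull : ∀ x r h₂ h₃ → x * (h₂ * (2 + 2 * r)) * h₃ ≡ 2 * h₂ * h₃ * (x * suc r)
    pull = solve-∀
    combine : ∀ y K h₂ h₃ → 2 * h₂ * h₃ * (y * suc K) + y * h₂ * (1 * h₃) ≡ y * h₂ * (h₃ * (3 + 2 * K))
    combine = solve-∀

  -- n ↦ histories 2 n² (n+1) / histories 3 n² is non-increasing, since
  -- (2n+2)² (n+2) ≤ (2n+3)² (n+1)
  ratio-decreasing : ∀ K r →
    histories 3 K * histories 3 K * (histories 2 (K + r) * histories 2 (K + r)) * suc (K + r)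
      ≤ histories 3 (K + r) * histories 3 (K + r) * (histories 2 K * histories 2 K) * suc K
  ratio-decreasing K zero rewrite +-identityʳ K = ≤-refl
  ratio-decreasing K (suc r) rewrite +-suc K r | histories-last 3 (K + r) | histories-last 2 (K + r) = begin
    h₃K * h₃K * ((h₂ * (2 + 2 * n)) * (h₂ * (2 + 2 * n))) * suc (suc n)
      ≡⟨ separate h₃K h₂ n ⟩
    (h₃K * h₃K * (h₂ * h₂)) * ((2 + 2 * n) * (2 + 2 * n) * (2 + n))
      ≤⟨ *-monoʳ-≤ (h₃K * h₃K * (h₂ * h₂)) (step-factor n) ⟩
    (h₃K * h₃K * (h₂ * h₂)) * ((1 + n) * ((3 + 2 * n) * (3 + 2 * n)))
      ≡⟨ *-assoc (h₃K * h₃K * (h₂ * h₂)) (1 + n) _ ⟨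
    (h₃K * h₃K * (h₂ * h₂) * suc n) * ((3 + 2 * n) * (3 + 2 * n))
      ≤⟨ *-monoˡ-≤ ((3 + 2 * n) * (3 + 2 * n)) (ratio-decreasing K r) ⟩
    (h₃ * h₃ * (h₂K * h₂K) * suc K) * ((3 + 2 * n) * (3 + 2 * n))
      ≡⟨ merge h₃ n (h₂K * h₂K) (suc K) ⟩
    h₃ * (3 + 2 * n) * (h₃ * (3 + 2 * n)) * (h₂K * h₂K) * suc K ∎
    where
    open ≤-Reasoning
    n = K + r
    h₂ = histories 2 n
    h₃ = histories 3 n
    h₂K = histories 2 K
    h₃K = histories 3 K
    separate : ∀ a b n → a * a * ((b * (2 + 2 * n)) * (b * (2 + 2 * n))) * suc (suc n) ≡
               (a * a * (b * b)) * ((2 + 2 * n) * (2 + 2 * n) * (2 + n))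
    separate = solve-∀
    merge : ∀ c n u v → (c * c * u * v) * ((3 + 2 * n) * (3 + 2 * n)) ≡
            c * (3 + 2 * n) * (c * (3 + 2 * n)) * u * v
    merge = solve-∀
    step-factor : ∀ n → (2 + 2 * n) * (2 + 2 * n) * (2 + n) ≤ (1 + n) * ((3 + 2 * n) * (3 + 2 * n))
    step-factor n = subst ((2 + 2 * n) * (2 + 2 * n) * (2 + n) ≤_) (sym (expand n)) (m≤m+n _ (1 + n))
      where expand : ∀ n → (1 + n) * ((3 + 2 * n) * (3 + 2 * n)) ≡ (2 + 2 * n) * (2 + 2 * n) * (2 + n) + (1 + n)
            expand = solve-∀

  childAtMost-squared : ∀ K r →
    diagSumUpTo K r childWeight * diagSumUpTo K r childWeight * suc (K + r)
      ≤ histories 3 (K + r) * histories 3 (K + r) * suc K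
  childAtMost-squared K r = *-cancelʳ-≤ _ _ (h₂K * h₂K) {{h₂K²-nonZero}} (begin
    T * T * suc n * (h₂K * h₂K)                               ≡⟨ regroup T h₂K (suc n) ⟩
    (T * h₂K) * (T * h₂K) * suc n                             ≡⟨ cong (λ z → z * z * suc n) T*h₂K ⟩
    (histories 3 K * histories 2 n) * (histories 3 K * histories 2 n) * suc n
                                                              ≡⟨ square-product (histories 3 K) (histories 2 n) (suc n) ⟩
    histories 3 K * histories 3 K * (histories 2 n * histories 2 n) * suc n
                                                              ≤⟨ ratio-decreasing K r ⟩
    histories 3 n * histories 3 n * (h₂K * h₂K) * suc K       ≡⟨ swap-last (histories 3 n) h₂K (suc K) ⟩
    histories 3 n * histories 3 n * suc K * (h₂K * h₂K) ∎)
    where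
    open ≤-Reasoning
    n = K + r
    T = diagSumUpTo K r childWeight
    h₂K = histories 2 K
    h₂K²-nonZero : NonZero (h₂K * h₂K)
    h₂K²-nonZero = >-nonZero (*-mono-< (histories-pos 2 K (s≤s z≤n)) (histories-pos 2 K (s≤s z≤n)))
    T*h₂K : T * h₂K ≡ histories 3 K * histories 2 n
    T*h₂K = begin-equality
      T * h₂K                                          ≡⟨ cong (_* h₂K) (childAtMost-closed K r) ⟩
      binom K r * histories 2 r * histories 3 K * h₂K  ≡⟨ rotate (binom K r) (histories 2 r) (histories 3 K) h₂K ⟩
      histories 3 K * (binom K r * histories 2 r * h₂K) ≡⟨ cong (histories 3 K *_) (binom-histories₂ K r) ⟩
      histories 3 K * histories 2 n ∎
      where rotate : ∀ b x y z → b * x * y * z ≡ y * (b * x * z)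
            rotate = solve-∀
    regroup : ∀ t b c → t * t * c * (b * b) ≡ (t * b) * (t * b) * c
    regroup = solve-∀
    square-product : ∀ a b c → (a * b) * (a * b) * c ≡ a * a * (b * b) * c
    square-product = solve-∀
    swap-last : ∀ a b c → a * a * (b * b) * c ≡ a * a * c * (b * b)
    swap-last = solve-∀

  -- all histories of length n from ran₁, grouped by the steps in one child
  diagSum-childWeight : ∀ n → diagSum n childWeight ≡ histories 3 n
  diagSum-childWeight n = begin
    diagSum n childWeight
      ≡⟨ diagSum-cong n (λ i j → cong (interleavings 2 i j *_)
                              (sym (trans (histSum-const i face 1) (*-identityˡ _)))) ⟩
    diagSum n (λ i j → interleavings 2 i j * histSum i face (λ _ → 1))
      ≡⟨ sym (histSum-child first n (λ _ → 1)) ⟩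
    histSum n ran₁ (λ _ → 1)
      ≡⟨ trans (histSum-const n ran₁ 1) (*-identityˡ _) ⟩
    histories 3 n ∎
    where open ≡-Reasoning

  historiesUpTo : ℕ → ℕ → ℕ
  historiesUpTo K i with i ≤? K
  ... | yes _ = histories 1 i
  ... | no  _ = 0

  -- a 0/1-valued function that vanishes on triangles with more than
  -- 2K+1 faces sums, over histories of length i from a face, to at most
  -- historiesUpTo K i (outcomes have 1 + 2i faces)
  histSum-face-upTo : ∀ i K f → (∀ y → f y ≤ 1) → (∀ y → 2 * K + 1 < faces y → f y ≡ 0) →
                      histSum i face f ≤ historiesUpTo K i
  histSum-face-upTo i K f f≤1 f≡0 with i ≤? K
  ... | yes _   = subst (histSum i face f ≤_) (*-identityˡ _) (histSum-bound i face f 1 (λ s _ → f≤1 s))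
  ... | no  i≰K = subst (histSum i face f ≤_) (*-zeroˡ (histories 1 i)) (histSum-bound i face f 0 vanish)
    where
    vanish : ∀ s → faces s ≡ 1 + 2 * i → f s ≤ 0
    vanish s eq = ≤-reflexive (f≡0 s (subst (2 * K + 1 <_) (sym eq) (+-comm-< (*-monoʳ-< 2 (≰⇒> i≰K)))))
      where +-comm-< : 2 * K < 2 * i → 2 * K + 1 < 1 + 2 * i
            +-comm-< lt = subst (_< 1 + 2 * i) (+-comm 1 (2 * K)) (s≤s lt)

  childTail : ∀ π n K f → (∀ y → f y ≤ 1) → (∀ y → 2 * K + 1 < faces y → f y ≡ 0) →
    let c = histSum n ran₁ (λ t → f (child π t)) in c * c * suc n ≤ histories 3 n * histories 3 n * suc K
  childTail π n K f f≤1 f≡0 with ≤-total n K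
  ... | inj₁ n≤K = *-mono-≤ (*-mono-≤ c≤all c≤all) (s≤s n≤K)
    where
    c≤all : histSum n ran₁ (λ t → f (child π t)) ≤ histories 3 n
    c≤all = subst (histSum n ran₁ (λ t → f (child π t)) ≤_) (*-identityˡ _)
              (histSum-bound n ran₁ _ 1 (λ s _ → f≤1 (child π s)))
  ... | inj₂ K≤n = subst TailBound (m+[n∸m]≡n K≤n) (beyond (n ∸ K))
    where
    c : ℕ → ℕ
    c m = histSum m ran₁ (λ t → f (child π t))
    TailBound : ℕ → Set
    TailBound m = c m * c m * suc m ≤ histories 3 m * histories 3 m * suc K
    beyond : ∀ r → TailBound (K + r)
    beyond r = ≤-trans (*-monoˡ-≤ (suc (K + r)) (*-mono-≤ c≤upTo c≤upTo)) (childAtMost-squared K r)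
      where
      c≤upTo : c (K + r) ≤ diagSumUpTo K r childWeight
      c≤upTo = begin
        c (K + r)
          ≡⟨ histSum-child π (K + r) f ⟩
        diagSum (K + r) (λ i j → interleavings 2 i j * histSum i face f)
          ≤⟨ diagSum-mono (K + r) (λ i j → *-monoʳ-≤ (interleavings 2 i j) (histSum-face-upTo i K f f≤1 f≡0)) ⟩
        diagSum (K + r) (λ i j → interleavings 2 i j * historiesUpTo K i)
          ≡⟨ diagSum-truncate K r childWeight _ below above ⟩
        diagSumUpTo K r childWeight ∎
        where
        open ≤-Reasoning
        below : ∀ i j → i ≤ K → interleavings 2 i j * historiesUpTo K i ≡ childWeight i j
        below i j i≤K with i ≤? K
        ... | yes _   = refl
        ... | no  i≰K = contradiction i≤K i≰K
        above : ∀ i j → K < i → interleavings 2 i j * historiesUpTo K i ≡ 0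
        above i j K<i with i ≤? K
        ... | yes i≤K = contradiction i≤K (<⇒≱ K<i)
        ... | no  _   = *-zeroʳ (interleavings 2 i j)

-- With an auxiliary a
-- (later a ≈ √(pq), so a/q ≈ p/a ≈ √ε), a triangle of the standard
-- 2-subdivision can only be small if some child of the root holds less
-- than the fraction a/q of all faces, or some grandchild holds less than
-- the fraction p/a of its parent: a union of 3 + 9 events.
module Covering where

  open ChildDecomposition using (Pos; first; second; third; child; Σpos)
  open import Data.Nat using (ℕ; _+_; _*_; _≤_; _<_; _⊓_; z≤n; s≤s; NonZero)
  open import Data.Nat.Properties
  open import Data.Product using (∃-syntax; _,_)
  open import Data.Sum using (inj₁; inj₂)
  open import Relation.Nullary using (Dec; yes; no; contradiction)
  open import Relation.Binary.PropositionalEquality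

  𝟙 : ∀ {A : Set} → Dec A → ℕ
  𝟙 (yes _) = 1
  𝟙 (no  _) = 0

  𝟙≤1 : ∀ {A : Set} (d : Dec A) → 𝟙 d ≤ 1
  𝟙≤1 (yes _) = ≤-refl
  𝟙≤1 (no  _) = z≤n

  min3-small : ∀ (h : Pos → ℕ) q X → ((h first ⊓ h second) ⊓ h third) * q < X → ∃[ π ] h π * q < X
  min3-small h q X small with ⊓-sel (h first ⊓ h second) (h third)
  ... | inj₂ eq = third , subst (λ m → m * q < X) eq small
  ... | inj₁ eq with ⊓-sel (h first) (h second)
  ...   | inj₁ eq′ = first  , subst (λ m → m * q < X) (trans eq eq′) small
  ...   | inj₂ eq′ = second , subst (λ m → m * q < X) (trans eq eq′) small

  Σpos-pos : ∀ (h : Pos → ℕ) π → 1 ≤ h π → 1 ≤ Σpos h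
  Σpos-pos h first  pos = ≤-trans (≤-trans pos (m≤m+n _ (h second))) (m≤m+n _ (h third))
  Σpos-pos h second pos = ≤-trans (≤-trans pos (m≤n+m _ (h first))) (m≤m+n _ (h third))
  Σpos-pos h third  pos = ≤-trans pos (m≤n+m _ (h first + h second))

  module Events (p q a M : ℕ) .{{_ : NonZero a}} where

    -- the child w holds less than the fraction a/q of the M faces
    smallChild : Tri → ℕ
    smallChild w = 𝟙 (faces w * q <? a * M)

    -- w holds at least the fraction a/q, but its child g holds less than
    -- the fraction p/a of w
    smallGrandchild : Pos → Tri → ℕ
    smallGrandchild g w with a * M ≤? faces w * q
    ... | yes _ = 𝟙 (faces (child g w) * a <? p * faces w)
    ... | no  _ = 0

    childEvents : Tri → ℕ
    childEvents w = smallChild w + Σpos (λ g → smallGrandchild g w)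

    -- the number of the 12 events that occur
    events : Tri → ℕ
    events t = Σpos (λ π → childEvents (child π t))

    relative-fraction : ∀ x F → x * q < p * M → a * M ≤ F * q → x * a < p * F
    relative-fraction x F x-small F-large = *-cancelʳ-< q _ _ (begin-strict
      x * a * q    ≡⟨ *-comm-last x a q ⟩
      x * q * a    <⟨ *-monoˡ-< a x-small ⟩
      p * M * a    ≡⟨ *-comm-last′ p M a ⟩
      p * (a * M)  ≤⟨ *-monoʳ-≤ p F-large ⟩
      p * (F * q)  ≡⟨ *-assoc p F q ⟨
      p * F * q    ∎)
      where
      open ≤-Reasoning
      *-comm-last : ∀ x y z → x * y * z ≡ x * z * y
      *-comm-last x y z = trans (*-assoc x y z) (trans (cong (x *_) (*-comm y z)) (sym (*-assoc x z y)))
      *-comm-last′ : ∀ x y z → x * y * z ≡ x * (z * y)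
      *-comm-last′ x y z = trans (*-assoc x y z) (cong (x *_) (*-comm y z))

    child-covered : q < M → ∀ w → sub3 w * q < p * M → 1 ≤ childEvents w
    child-covered q<M w small with faces w * q <? a * M
    ... | yes _ = s≤s z≤n
    ... | no w-large = ≤-trans (grandchild w small (≮⇒≥ w-large)) (m≤n+m _ 0)
      where
      grandchild : ∀ w → sub3 w * q < p * M → a * M ≤ faces w * q →
                   1 ≤ Σpos (λ g → smallGrandchild g w)
      grandchild face _ aM≤q = contradiction (≤-trans (≤-trans q<M (m≤n*m M a)) aM≤q)
                                             (≤⇒≯ (≤-reflexive (*-identityˡ q)))
      grandchild w@(node _ _ _) small aM≤Fq with min3-small (λ g → faces (child g w)) q (p * M) small
      ... | g , g-small = Σpos-pos (λ g → smallGrandchild g w) g hit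
        where
        hit : 1 ≤ smallGrandchild g w
        hit with a * M ≤? faces w * q
        ... | no aM≰Fq = contradiction aM≤Fq aM≰Fq
        ... | yes _ with faces (child g w) * a <? p * faces w
        ...   | yes _ = ≤-refl
        ...   | no ¬rel = contradiction (relative-fraction (faces (child g w)) (faces w) g-small aM≤Fq) ¬rel

    covering : 1 ≤ q → q < M → ∀ t → faces t ≡ M → minZ t * q < p * M → 1 ≤ events t
    covering 1≤q q<M face faces≡M _ = contradiction (≤-trans (≤-reflexive (sym faces≡M)) 1≤q) (<⇒≱ q<M)
    covering 1≤q q<M t@(node _ _ _) _ small with min3-small (λ π → sub3 (child π t)) q (p * M) small
    ... | π , π-small = Σpos-pos (λ π → childEvents (child π t)) π (child-covered q<M (child π t) π-small)

-- Elementary inequalities for bounds of the shape  β·x² ≤ α·y², i.e.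
-- x/y ≤ √(α/β); these let square-root bounds on probabilities be added
-- without leaving the natural numbers.
module SquareBounds where

  open import Data.Nat using (ℕ; zero; suc; _+_; _*_; _≤_; _<_; _∸_; NonZero; >-nonZero)
  open import Data.Nat.Properties
  open import Data.Nat.DivMod using (_/_; _%_; m≡m%n+[m/n]*n; m%n<n)
  open import Data.Product using (∃-syntax; _×_; _,_)
  open import Data.Sum using (inj₁; inj₂)
  open import Data.Nat.Tactic.RingSolver using (solve-∀)
  open import Relation.Binary.PropositionalEquality
  open import Relation.Nullary using (yes; no; contradiction)

  -- β·x² ≤ α·y²  (a record, so that its four indices can be inferred)
  record SqBound (β α x y : ℕ) : Set where
    constructor sq-bound
    field bound : β * (x * x) ≤ α * (y * y)
  open SqBound public

  square-cancel : ∀ u v → u * u ≤ v * v → u ≤ v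
  square-cancel u v u²≤v² with u ≤? v
  ... | yes u≤v = u≤v
  ... | no  u≰v = contradiction u²≤v² (<⇒≱ (*-mono-< (≰⇒> u≰v) (≰⇒> u≰v)))

  SqBound-+ : ∀ {α β x X y Y} → SqBound β α x y → SqBound β α X Y → SqBound β α (x + X) (y + Y)
  SqBound-+ {α} {β} {x} {X} {y} {Y} (sq-bound h₁) (sq-bound h₂) = sq-bound (begin
    β * ((x + X) * (x + X))                     ≡⟨ expand β x X ⟩
    β * (x * x) + 2 * (β * x * X) + β * (X * X) ≤⟨ +-mono-≤ (+-mono-≤ h₁ (*-monoʳ-≤ 2 cross)) h₂ ⟩
    α * (y * y) + 2 * (α * y * Y) + α * (Y * Y) ≡⟨ expand α y Y ⟨
    α * ((y + Y) * (y + Y)) ∎)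
    where
    open ≤-Reasoning
    expand : ∀ b x X → b * ((x + X) * (x + X)) ≡ b * (x * x) + 2 * (b * x * X) + b * (X * X)
    expand = solve-∀
    product : ∀ b x X → (b * x * X) * (b * x * X) ≡ (b * (x * x)) * (b * (X * X))
    product = solve-∀
    -- the cross terms, compared through their squares
    cross : β * x * X ≤ α * y * Y
    cross = square-cancel _ _ (begin
      (β * x * X) * (β * x * X)      ≡⟨ product β x X ⟩
      (β * (x * x)) * (β * (X * X))  ≤⟨ *-mono-≤ h₁ h₂ ⟩
      (α * (y * y)) * (α * (Y * Y))  ≡⟨ product α y Y ⟨
      (α * y * Y) * (α * y * Y) ∎)

  SqBound-scale : ∀ {α β x y} w → SqBound β α x y → SqBound β α (w * x) (w * y)
  SqBound-scale {α} {β} {x} {y} w (sq-bound h) = sq-bound (begin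
    β * ((w * x) * (w * x))   ≡⟨ pull β w x ⟩
    (w * w) * (β * (x * x))   ≤⟨ *-monoʳ-≤ (w * w) h ⟩
    (w * w) * (α * (y * y))   ≡⟨ pull α w y ⟨
    α * ((w * y) * (w * y)) ∎)
    where
    open ≤-Reasoning
    pull : ∀ b w x → b * ((w * x) * (w * x)) ≡ (w * w) * (b * (x * x))
    pull = solve-∀

  SqBound-mono : ∀ {α β x x′ y} → x ≤ x′ → SqBound β α x′ y → SqBound β α x y
  SqBound-mono {β = β} x≤x′ (sq-bound h) = sq-bound (≤-trans (*-monoʳ-≤ β (*-mono-≤ x≤x′ x≤x′)) h)

  SqBound-sum3 : ∀ {α β x₁ x₂ x₃ y} → SqBound β α x₁ y → SqBound β α x₂ y → SqBound β α x₃ y →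
                 SqBound β (9 * α) ((x₁ + x₂) + x₃) y
  SqBound-sum3 {α} {y = y} h₁ h₂ h₃ =
    sq-bound (≤-trans (bound (SqBound-+ (SqBound-+ h₁ h₂) h₃)) (≤-reflexive (triple-square α y)))
    where triple-square : ∀ α y → α * ((y + y + y) * (y + y + y)) ≡ 9 * α * (y * y)
          triple-square = solve-∀

  am-gm-ordered : ∀ {u v} → u ≤ v → 2 * (u * v) ≤ u * u + v * v
  am-gm-ordered {u} {v} u≤v = subst (λ v → 2 * (u * v) ≤ u * u + v * v) (m+[n∸m]≡n u≤v) (gap (v ∸ u))
    where
    square-gap : ∀ u d → u * u + (u + d) * (u + d) ≡ 2 * (u * (u + d)) + d * d
    square-gap = solve-∀
    gap : ∀ d → 2 * (u * (u + d)) ≤ u * u + (u + d) * (u + d)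
    gap d = subst (2 * (u * (u + d)) ≤_) (sym (square-gap u d)) (m≤m+n _ (d * d))

  am-gm : ∀ u v → 2 * (u * v) ≤ u * u + v * v
  am-gm u v with ≤-total u v
  ... | inj₁ u≤v = am-gm-ordered u≤v
  ... | inj₂ v≤u = subst₂ _≤_ (cong (2 *_) (*-comm v u)) (+-comm (v * v) (u * u)) (am-gm-ordered v≤u)

  -- 3(X+Y)² ≤ 12X² + 4Y²  (Cauchy–Schwarz with weights 1/4, 3/4)
  weighted-square : ∀ X Y → 3 * ((X + Y) * (X + Y)) ≤ 12 * (X * X) + 4 * (Y * Y)
  weighted-square X Y = begin
    3 * ((X + Y) * (X + Y))                                    ≡⟨ expand X Y ⟩
    3 * (X * X) + 2 * ((3 * X) * Y) + 3 * (Y * Y)              ≤⟨ +-monoˡ-≤ (3 * (Y * Y)) (+-monoʳ-≤ (3 * (X * X)) (am-gm (3 * X) Y)) ⟩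
    3 * (X * X) + ((3 * X) * (3 * X) + Y * Y) + 3 * (Y * Y)    ≡⟨ collect X Y ⟩
    12 * (X * X) + 4 * (Y * Y) ∎
    where
    open ≤-Reasoning
    expand : ∀ X Y → 3 * ((X + Y) * (X + Y)) ≡ 3 * (X * X) + 2 * ((3 * X) * Y) + 3 * (Y * Y)
    expand = solve-∀
    collect : ∀ X Y → 3 * (X * X) + ((3 * X) * (3 * X) + Y * Y) + 3 * (Y * Y) ≡ 12 * (X * X) + 4 * (Y * Y)
    collect = solve-∀

  -- for any X and d > 0 there is K with  2Kd ≤ X < (2K+2)d  (K = ⌊X / 2d⌋)
  halving : ∀ X d .{{_ : NonZero d}} → ∃[ K ] (2 * K * d ≤ X × X < (2 * K + 2) * d)
  halving X d = K , lower , upper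
    where
    instance
      2d-nonZero : NonZero (2 * d)
      2d-nonZero = m*n≢0 2 d
    K = X / (2 * d)
    reorder : ∀ K d → K * (2 * d) ≡ 2 * K * d
    reorder = solve-∀
    reorder′ : ∀ K d → 2 * d + K * (2 * d) ≡ (2 * K + 2) * d
    reorder′ = solve-∀
    lower : 2 * K * d ≤ X
    lower = subst₂ _≤_ (reorder K d) (sym (m≡m%n+[m/n]*n X (2 * d))) (m≤n+m (K * (2 * d)) (X % (2 * d)))
    upper : X < (2 * K + 2) * d
    upper = subst₂ _<_ (sym (m≡m%n+[m/n]*n X (2 * d))) (reorder′ K d) (+-monoˡ-< (K * (2 * d)) (m%n<n X (2 * d)))

  combined-bound : ∀ a p q N X Y → SqBound (10 * q) (99 * a) X N → SqBound (10 * a) (891 * p) Y N →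
                   30 * a * q * ((X + Y) * (X + Y)) ≤ 1188 * (a * a + 3 * (p * q)) * (N * N)
  combined-bound a p q N X Y (sq-bound hX) (sq-bound hY) = begin
    30 * a * q * ((X + Y) * (X + Y))                         ≡⟨ triple a q ((X + Y) * (X + Y)) ⟩
    10 * a * q * (3 * ((X + Y) * (X + Y)))                   ≤⟨ *-monoʳ-≤ (10 * a * q) (weighted-square X Y) ⟩
    10 * a * q * (12 * (X * X) + 4 * (Y * Y))                ≡⟨ distribute a q X Y ⟩
    12 * a * (10 * q * (X * X)) + 4 * q * (10 * a * (Y * Y)) ≤⟨ +-mono-≤ (*-monoʳ-≤ (12 * a) hX) (*-monoʳ-≤ (4 * q) hY) ⟩
    12 * a * (99 * a * (N * N)) + 4 * q * (891 * p * (N * N)) ≡⟨ collect a p q N ⟩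
    1188 * (a * a + 3 * (p * q)) * (N * N) ∎
    where
    open ≤-Reasoning
    triple : ∀ a q W → 30 * a * q * W ≡ 10 * a * q * (3 * W)
    triple = solve-∀
    distribute : ∀ a q X Y → 10 * a * q * (12 * (X * X) + 4 * (Y * Y)) ≡
                 12 * a * (10 * q * (X * X)) + 4 * q * (10 * a * (Y * Y))
    distribute = solve-∀
    collect : ∀ a p q N → 12 * a * (99 * a * (N * N)) + 4 * q * (891 * p * (N * N)) ≡
              1188 * (a * a + 3 * (p * q)) * (N * N)
    collect = solve-∀

  -- for  e ≤ s ≤ 4e  (here s = a², e = pq):  (s + 3e)² ≤ 16 s e
  window-bound : ∀ s e → e ≤ s → s ≤ 4 * e → (s + 3 * e) * (s + 3 * e) ≤ 16 * s * e
  window-bound s e e≤s s≤4e = subst (λ s → (s + 3 * e) * (s + 3 * e) ≤ 16 * s * e) (m+[n∸m]≡n e≤s) (offset (s ∸ e) d≤8e)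
    where
    d≤8e : s ∸ e ≤ 8 * e
    d≤8e = ≤-trans (m∸n≤m s e) (≤-trans s≤4e (*-monoˡ-≤ e (m≤m+n 4 4)))
    offset : ∀ d → d ≤ 8 * e → (e + d + 3 * e) * (e + d + 3 * e) ≤ 16 * (e + d) * e
    offset d d≤8e = begin
      (e + d + 3 * e) * (e + d + 3 * e)        ≡⟨ expand e d ⟩
      16 * (e * e) + 8 * (e * d) + d * d       ≤⟨ +-monoʳ-≤ (16 * (e * e) + 8 * (e * d))
                                                    (≤-trans (*-monoˡ-≤ d d≤8e) (≤-reflexive (*-assoc 8 e d))) ⟩
      16 * (e * e) + 8 * (e * d) + 8 * (e * d) ≡⟨ collect e d ⟩
      16 * (e + d) * e ∎
      where
      open ≤-Reasoning
      expand : ∀ e d → (e + d + 3 * e) * (e + d + 3 * e) ≡ 16 * (e * e) + 8 * (e * d) + d * d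
      expand = solve-∀
      collect : ∀ e d → 16 * (e * e) + 8 * (e * d) + 8 * (e * d) ≡ 16 * (e + d) * e
      collect = solve-∀

  fourth-power-bound : ∀ a p q N X Y c → 1 ≤ a → 1 ≤ p → 1 ≤ q → 1 ≤ N →
    p * q ≤ a * a → a * a ≤ 4 * (p * q) → c ≤ X + Y →
    SqBound (10 * q) (99 * a) X N → SqBound (10 * a) (891 * p) Y N →
    q * (c * c * c * c) < 28561 * p * (N * N * N * N)
  fourth-power-bound a p q N X Y c 1≤a 1≤p 1≤q 1≤N pq≤a² a²≤4pq c≤X+Y hX hY =
    *-cancelˡ-< (900 * (a * a) * q) _ _ (begin-strict
      900 * (a * a) * q * (q * (c * c * c * c))        ≡⟨ squares 900 a q c ⟩
      900 * (a * a) * q * q * ((c * c) * (c * c))      ≤⟨ *-monoʳ-≤ (900 * (a * a) * q * q) (*-mono-≤ c²≤W c²≤W) ⟩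
      900 * (a * a) * q * q * (W * W)                  ≡⟨ as-square 30 a q W ⟩
      (30 * a * q * W) * (30 * a * q * W)              ≤⟨ *-mono-≤ (combined-bound a p q N X Y hX hY) (combined-bound a p q N X Y hX hY) ⟩
      (1188 * S * (N * N)) * (1188 * S * (N * N))      ≡⟨ split-square 1188 S N ⟩
      1411344 * (S * S) * (N * N * (N * N))            ≤⟨ *-monoˡ-≤ (N * N * (N * N))
                                                           (*-monoʳ-≤ 1411344 {S * S} {16 * (a * a) * (p * q)} (window-bound (a * a) (p * q) pq≤a² a²≤4pq)) ⟩
      1411344 * (16 * (a * a) * (p * q)) * (N * N * (N * N)) ≡⟨ gather 1411344 a p q N ⟩
      22581504 * Z                                     <⟨ *-monoˡ-< Z {{Z-nonZero}} {22581504} {25704900} (m≤m+n 22581505 3123395) ⟩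
      25704900 * Z                                     ≡⟨ distribute 900 28561 a p q N ⟩
      900 * (a * a) * q * (28561 * p * (N * N * N * N)) ∎)
    where
    open ≤-Reasoning
    W = (X + Y) * (X + Y)
    S = a * a + 3 * (p * q)
    Z = a * a * (p * q) * (N * N * (N * N))
    Z-nonZero : NonZero Z
    Z-nonZero = >-nonZero (*-mono-< (*-mono-< (*-mono-< 1≤a 1≤a) (*-mono-< 1≤p 1≤q))
                                    (*-mono-< (*-mono-< 1≤N 1≤N) (*-mono-< 1≤N 1≤N)))
    c²≤W : c * c ≤ W
    c²≤W = *-mono-≤ c≤X+Y c≤X+Y
    squares : ∀ k a q c → k * (a * a) * q * (q * (c * c * c * c)) ≡ k * (a * a) * q * q * ((c * c) * (c * c))
    squares = solve-∀
    as-square : ∀ k a q W → (k * k) * (a * a) * q * q * (W * W) ≡ (k * a * q * W) * (k * a * q * W)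
    as-square = solve-∀
    split-square : ∀ k S N → (k * S * (N * N)) * (k * S * (N * N)) ≡ (k * k) * (S * S) * (N * N * (N * N))
    split-square = solve-∀
    gather : ∀ k a p q N → k * (16 * (a * a) * (p * q)) * (N * N * (N * N)) ≡ (k * 16) * (a * a * (p * q) * (N * N * (N * N)))
    gather = solve-∀
    distribute : ∀ k l a p q N → (k * l) * (a * a * (p * q) * (N * N * (N * N))) ≡ k * (a * a) * q * (l * p * (N * N * N * N))
    distribute = solve-∀

  square-window : ∀ k → ∃[ a ] (suc k ≤ a * a × a * a ≤ 4 * suc k)
  square-window zero = 1 , ≤-refl , m≤m+n 1 3
  square-window (suc k) with square-window k
  ... | a , k<a² , a²≤4k+4 with suc (suc k) ≤? a * a
  ...   | yes k+1<a² = a , k+1<a² , ≤-trans a²≤4k+4 (*-monoʳ-≤ 4 (n≤1+n (suc k)))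
  ...   | no  k+1≮a² = 2 * a , lower , upper
    where
    a²≡k+1 : a * a ≡ suc k
    a²≡k+1 = ≤-antisym (≤-pred (≰⇒> k+1≮a²)) k<a²
    quadruple : ∀ a → (2 * a) * (2 * a) ≡ 4 * (a * a)
    quadruple = solve-∀
    [2a]²≡4k+4 : (2 * a) * (2 * a) ≡ 4 * suc k
    [2a]²≡4k+4 = trans (quadruple a) (cong (4 *_) a²≡k+1)
    lower : suc (suc k) ≤ (2 * a) * (2 * a)
    lower = ≤-trans (m≤m+n (suc (suc k)) (2 + 3 * k)) (≤-reflexive (trans (spread k) (sym [2a]²≡4k+4)))
      where spread : ∀ k → suc (suc k) + (2 + 3 * k) ≡ 4 * suc k
            spread = solve-∀
    upper : (2 * a) * (2 * a) ≤ 4 * suc (suc k)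
    upper = ≤-trans (≤-reflexive [2a]²≡4k+4) (*-monoʳ-≤ 4 (n≤1+n (suc k)))

-- Probability bounds for the twelve events, as square-root bounds on
-- history counts  (N = number of histories, M = final number of faces).
module EventBounds where

  open Histories
  open ChildDecomposition
  open ChildTail
  open Covering
  open SquareBounds
  open import Data.Nat using (ℕ; zero; suc; _+_; _*_; _∸_; _≤_; _<_; z≤n; s≤s; NonZero; >-nonZero⁻¹)
  open import Data.Nat.Properties
  open import Data.Product using (_,_)
  open import Data.Nat.Tactic.RingSolver using (solve-∀)
  open import Relation.Binary.PropositionalEquality
  open import Relation.Nullary using (yes; no; contradiction)

  diagSum-SqBound : ∀ n α β (x y : ℕ → ℕ → ℕ) → (∀ i j → SqBound β α (x i j) (y i j)) →
                    SqBound β α (diagSum n x) (diagSum n y)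
  diagSum-SqBound zero    α β x y xy = xy 0 0
  diagSum-SqBound (suc n) α β x y xy =
    SqBound-+ (xy 0 (suc n)) (diagSum-SqBound n α β (λ i → x (suc i)) (λ i → y (suc i)) (λ i → xy (suc i)))

  tail-arith : ∀ u d n K → 1 ≤ u → 4 + 10 * d ≤ n → 2 * K * d ≤ u * (3 + 2 * n) →
               10 * d * suc K ≤ 11 * u * suc n
  tail-arith u d n K 1≤u n-large 2Kd≤X = begin
    10 * d * suc K                                       ≡⟨ split-K d K ⟩
    5 * (2 * K * d) + 10 * d                             ≤⟨ +-monoˡ-≤ (10 * d) (*-monoʳ-≤ 5 2Kd≤X) ⟩
    5 * (u * (3 + 2 * n)) + 10 * d                       ≤⟨ m≤m+n _ (10 * d * u′ + u * e) ⟩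
    5 * (u * (3 + 2 * n)) + 10 * d + (10 * d * u′ + u * e)
      ≡⟨ cong₂ (λ u n → 5 * (u * (3 + 2 * n)) + 10 * d + (10 * d * u′ + u * e)) u≡ n≡ ⟩
    5 * ((1 + u′) * (3 + 2 * (4 + 10 * d + e))) + 10 * d + (10 * d * u′ + (1 + u′) * e)
      ≡⟨ identity d u′ e ⟩
    11 * (1 + u′) * suc (4 + 10 * d + e)
      ≡⟨ cong₂ (λ u n → 11 * u * suc n) (sym u≡) (sym n≡) ⟩
    11 * u * suc n ∎
    where
    open ≤-Reasoning
    u′ = u ∸ 1
    e = n ∸ (4 + 10 * d)
    u≡ : u ≡ 1 + u′
    u≡ = sym (m+[n∸m]≡n 1≤u)
    n≡ : n ≡ 4 + 10 * d + e
    n≡ = sym (m+[n∸m]≡n n-large)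
    split-K : ∀ d K → 10 * d * suc K ≡ 5 * (2 * K * d) + 10 * d
    split-K = solve-∀
    identity : ∀ d u′ e → 5 * ((1 + u′) * (3 + 2 * (4 + 10 * d + e))) + 10 * d + (10 * d * u′ + (1 + u′) * e)
                          ≡ 11 * (1 + u′) * suc (4 + 10 * d + e)
    identity = solve-∀

  -- The probability that a child of the root ends with less than the
  -- fraction u/d of the  3 + 2n  faces is at most  √(1.1·u/d), for n large.
  fraction-tail : ∀ π n u d .{{_ : NonZero d}} → 1 ≤ u → 4 + 10 * d ≤ n →
    SqBound (10 * d) (11 * u) (histSum n ran₁ (λ t → 𝟙 (faces (child π t) * d <? u * (3 + 2 * n))))
                              (histories 3 n)
  fraction-tail π n u d 1≤u n-large with halving (u * (3 + 2 * n)) d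
  ... | K , 2Kd≤X , X<[2K+2]d = sq-bound (*-cancelʳ-≤ _ _ (suc n) (begin
    10 * d * (c * c) * suc n                    ≡⟨ *-assoc (10 * d) (c * c) (suc n) ⟩
    10 * d * (c * c * suc n)                    ≤⟨ *-monoʳ-≤ (10 * d) (childTail π n K small 𝟙≤1-small vanish) ⟩
    10 * d * (N * N * suc K)                    ≡⟨ rotate (10 * d) (N * N) (suc K) ⟩
    N * N * (10 * d * suc K)                    ≤⟨ *-monoʳ-≤ (N * N) (tail-arith u d n K 1≤u n-large 2Kd≤X) ⟩
    N * N * (11 * u * suc n)                    ≡⟨ rotate′ (11 * u) (N * N) (suc n) ⟩
    11 * u * (N * N) * suc n ∎))
    where
    open ≤-Reasoning
    X = u * (3 + 2 * n)
    N = histories 3 n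
    small : Tri → ℕ
    small y = 𝟙 (faces y * d <? X)
    c = histSum n ran₁ (λ t → small (child π t))
    𝟙≤1-small : ∀ y → small y ≤ 1
    𝟙≤1-small y = 𝟙≤1 (faces y * d <? X)
    -- a triangle with at least 2K+2 faces is not small
    vanish : ∀ y → 2 * K + 1 < faces y → small y ≡ 0
    vanish y K<y with faces y * d <? X
    ... | no  _        = refl
    ... | yes y-small  = contradiction (≤-trans X<[2K+2]d (*-monoˡ-≤ d (≤-trans (≤-reflexive (+-suc (2 * K) 1)) K<y)))
                                       (<⇒≯ y-small)
    rotate : ∀ a b c → a * (b * c) ≡ b * (a * c)
    rotate = solve-∀
    rotate′ : ∀ a b c → b * (a * c) ≡ a * b * c
    rotate′ = solve-∀

  module Estimates (p q a n : ℕ) .{{_ : NonZero p}} .{{_ : NonZero q}} .{{_ : NonZero a}}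
                   (n≥10q : 4 + 10 * q ≤ n) (n≥10aq : (10 * a + 5) * q ≤ n) where

    M N : ℕ
    M = 3 + 2 * n
    N = histories 3 n

    open Events p q a M public

    q<M : q < M
    q<M = s≤s (≤-trans (m≤n*m q 10) (≤-trans (m≤n+m (10 * q) 4) (≤-trans n≥10q (≤-trans (m≤m+n n n) n≤2n+2))))
      where n≤2n+2 : n + n ≤ 2 + 2 * n
            n≤2n+2 = ≤-trans (≤-reflexive (cong (n +_) (sym (+-identityʳ n)))) (m≤n+m (2 * n) 2)

    smallChild-bound : ∀ π → SqBound (10 * q) (11 * a) (histSum n ran₁ (λ t → smallChild (child π t))) N
    smallChild-bound π = fraction-tail π n a q (>-nonZero⁻¹ a) n≥10q

    large-child-steps : ∀ i → a * M ≤ (3 + 2 * i) * q → 4 + 10 * a ≤ i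
    large-child-steps i large with 4 + 10 * a ≤? i
    ... | yes i-large = i-large
    ... | no  i≰     = contradiction large (<⇒≱ (begin-strict
      (3 + 2 * i) * q              ≤⟨ *-monoˡ-≤ q (+-monoʳ-≤ 3 (*-monoʳ-≤ 2 i≤)) ⟩
      (3 + 2 * (3 + 10 * a)) * q   ≡⟨ expand a q ⟩
      (20 * a + 9) * q             <⟨ m<m+n _ (>-nonZero⁻¹ q) ⟩
      (20 * a + 9) * q + q         ≡⟨ double a q ⟩
      2 * ((10 * a + 5) * q)       ≤⟨ *-monoʳ-≤ 2 n≥10aq ⟩
      2 * n                        ≤⟨ m≤n+m _ 3 ⟩
      M                            ≤⟨ m≤n*m M a ⟩
      a * M ∎))
      where
      open ≤-Reasoning
      i≤ : i ≤ 3 + 10 * a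
      i≤ = ≤-pred (≰⇒> i≰)
      expand : ∀ a q → (3 + 2 * (3 + 10 * a)) * q ≡ (20 * a + 9) * q
      expand = solve-∀
      double : ∀ a q → (20 * a + 9) * q + q ≡ 2 * ((10 * a + 5) * q)
      double = solve-∀

    smallGrandchild-face : ∀ g i → SqBound (10 * a) (11 * p) (histSum i face (smallGrandchild g)) (histories 1 i)
    smallGrandchild-face g i with a * M ≤? (1 + 2 * i) * q
    ... | no small = subst (λ c → SqBound (10 * a) (11 * p) c (histories 1 i)) (sym c≡0)
                           (sq-bound (≤-trans (≤-reflexive (*-zeroʳ (10 * a))) z≤n))
      where
      vanish : ∀ s → faces s ≡ 1 + 2 * i → smallGrandchild g s ≤ 0
      vanish s eq with a * M ≤? faces s * q
      ... | yes large = contradiction (subst (λ F → a * M ≤ F * q) eq large) small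
      ... | no  _     = z≤n
      c≡0 : histSum i face (smallGrandchild g) ≡ 0
      c≡0 = n≤0⇒n≡0 (subst (histSum i face (smallGrandchild g) ≤_) (*-zeroˡ (histories 1 i))
                             (histSum-bound i face _ 0 vanish))
    ... | yes large with i
    ...   | zero = contradiction (≤-trans (≤-trans q<M (m≤n*m M a)) large) (<-irrefl (sym (*-identityˡ q)))
    ...   | suc i′ = subst (SqBound (10 * a) (11 * p) _) (sym (*-identityˡ (histories 3 i′)))
                           (SqBound-mono c≤c′ (fraction-tail g i′ p a (>-nonZero⁻¹ p) i′-large))
      where
      i′-large : 4 + 10 * a ≤ i′
      i′-large = large-child-steps i′ (subst (λ F → a * M ≤ F * q) (shift i′) large)
        where shift : ∀ i → 1 + 2 * suc i ≡ 3 + 2 * i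
              shift = solve-∀
      -- after its forced first step the child is ran₁ with i′ steps to go
      c≤c′ : histSum (suc i′) face (smallGrandchild g)
             ≤ histSum i′ ran₁ (λ t → 𝟙 (faces (child g t) * a <? p * (3 + 2 * i′)))
      c≤c′ = ≤-trans (≤-reflexive (+-identityʳ _)) (histSum-mono i′ ran₁ _ _ pointwise)
        where
        pointwise : ∀ s → faces s ≡ 3 + 2 * i′ →
                    smallGrandchild g s ≤ 𝟙 (faces (child g s) * a <? p * (3 + 2 * i′))
        pointwise s eq with a * M ≤? faces s * q
        ... | yes _ = ≤-reflexive (cong (λ F → 𝟙 (faces (child g s) * a <? p * F)) eq)
        ... | no  _ = z≤n

    smallGrandchild-bound : ∀ π g →
      SqBound (10 * a) (11 * p) (histSum n ran₁ (λ t → smallGrandchild g (child π t))) N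
    smallGrandchild-bound π g =
      subst₂ (SqBound (10 * a) (11 * p)) (sym (histSum-child π n (smallGrandchild g))) (diagSum-childWeight n)
        (diagSum-SqBound n (11 * p) (10 * a) _ _ (λ i j →
          SqBound-scale (interleavings 2 i j) (smallGrandchild-face g i)))

    events-bound : p * q ≤ a * a → a * a ≤ 4 * (p * q) → ∀ f → (∀ t → faces t ≡ M → f t ≤ events t) →
                   let c = histSum n ran₁ f in q * (c * c * c * c) < 28561 * p * (N * N * N * N)
    events-bound pq≤a² a²≤4pq f f≤events =
      fourth-power-bound a p q N X Y (histSum n ran₁ f)
        (>-nonZero⁻¹ a) (>-nonZero⁻¹ p) (>-nonZero⁻¹ q) (histories-pos 3 n (s≤s z≤n))
        pq≤a² a²≤4pq c≤X+Y
        (subst (λ α → SqBound (10 * q) α X N) (nine-times-eleven a)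
               (SqBound-sum3 (smallChild-bound first) (smallChild-bound second) (smallChild-bound third)))
        (subst (λ α → SqBound (10 * a) α Y N) (eighty-one-times-eleven p)
               (SqBound-sum3 (grandchildren first) (grandchildren second) (grandchildren third)))
      where
      childCount : Pos → ℕ
      childCount π = histSum n ran₁ (λ t → smallChild (child π t))
      grandchildCount : Pos → Pos → ℕ
      grandchildCount π g = histSum n ran₁ (λ t → smallGrandchild g (child π t))
      X Y : ℕ
      X = Σpos childCount
      Y = Σpos (λ π → Σpos (grandchildCount π))
      grandchildren : ∀ π → SqBound (10 * a) (9 * (11 * p)) (Σpos (grandchildCount π)) N
      grandchildren π = SqBound-sum3 (smallGrandchild-bound π first) (smallGrandchild-bound π second)
                                     (smallGrandchild-bound π third)
      count-events : histSum n ran₁ events ≡ X + Y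
      count-events = begin
        histSum n ran₁ events
          ≡⟨ histSum-Σpos n ran₁ (λ π t → childEvents (child π t)) ⟩
        Σpos (λ π → histSum n ran₁ (λ t → childEvents (child π t)))
          ≡⟨ Σpos-cong (λ π → trans (histSum-+ n ran₁ _ _)
                                    (cong (childCount π +_) (histSum-Σpos n ran₁ (λ g t → smallGrandchild g (child π t))))) ⟩
        Σpos (λ π → childCount π + Σpos (grandchildCount π))
          ≡⟨ Σpos-+ childCount (λ π → Σpos (grandchildCount π)) ⟩
        X + Y ∎
        where open ≡-Reasoning
      c≤X+Y : histSum n ran₁ f ≤ X + Y
      c≤X+Y = ≤-trans (histSum-mono n ran₁ f events f≤events) (≤-reflexive count-events)
      nine-times-eleven : ∀ a → 9 * (11 * a) ≡ 99 * a
      nine-times-eleven = solve-∀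
      eighty-one-times-eleven : ∀ p → 9 * (9 * (11 * p)) ≡ 891 * p
      eighty-one-times-eleven = solve-∀

module RationalCounting where

  open Histories using (histSum; histories; faces-subdivide)
  open import Data.Nat as ℕ using (ℕ; zero; suc)
  import Data.Nat.Properties as ℕ
  open import Data.Integer as ℤ using (+_; +<+)
  import Data.Integer.Properties as ℤ
  open import Data.Rational using (ℚ; mkℚ; 0ℚ; 1ℚ; _+_; _*_; _<_; _/_; *<*; toℚᵘ; _<?_)
  open import Data.Rational.Properties
  import Data.Rational.Unnormalised as ℚᵘ
  import Data.Rational.Unnormalised.Properties as ℚᵘ
  open import Data.Nat.Coprimality using (Coprime; 1-coprimeTo) renaming (sym to coprime-sym)
  open import Data.Bool using (Bool; true; false)
  open import Data.Fin using (Fin)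
  import Data.Fin as Fin using (zero; suc)
  open import Relation.Nullary using (Dec; yes; no; does)
  open import Relation.Binary.PropositionalEquality

  ι : ℕ → ℚ
  ι k = mkℚ (+ k) 0 (coprime-sym (1-coprimeTo k))

  ι-+ : ∀ a b → ι (a ℕ.+ b) ≡ ι a + ι b
  ι-+ a b = toℚᵘ-injective (ℚᵘ.≃-trans (ℚᵘ.*≡* eq) (ℚᵘ.≃-sym (toℚᵘ-homo-+ (ι a) (ι b))))
    where
    eq : + (a ℕ.+ b) ℤ.* + 1 ≡ (+ a ℤ.* + 1 ℤ.+ + b ℤ.* + 1) ℤ.* + 1
    eq = trans (ℤ.*-identityʳ _) (trans (ℤ.pos-+ a b)
           (sym (trans (ℤ.*-identityʳ _) (cong₂ ℤ._+_ (ℤ.*-identityʳ (+ a)) (ℤ.*-identityʳ (+ b))))))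

  ι-* : ∀ a b → ι (a ℕ.* b) ≡ ι a * ι b
  ι-* a b = toℚᵘ-injective (ℚᵘ.≃-trans (ℚᵘ.*≡* eq) (ℚᵘ.≃-sym (toℚᵘ-homo-* (ι a) (ι b))))
    where
    eq : + (a ℕ.* b) ℤ.* + 1 ≡ (+ a ℤ.* + b) ℤ.* + 1
    eq = trans (ℤ.*-identityʳ _) (trans (ℤ.pos-* a b) (sym (ℤ.*-identityʳ _)))

  ι-< : ∀ a b → a ℕ.< b → ι a < ι b
  ι-< a b a<b = *<* (subst₂ ℤ._<_ (sym (ℤ.*-identityʳ (+ a))) (sym (ℤ.*-identityʳ (+ b))) (+<+ a<b))

  ι-fourth : ∀ c → ι (c ℕ.* c ℕ.* c ℕ.* c) ≡ ι c * ι c * ι c * ι c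
  ι-fourth c = trans (ι-* (c ℕ.* c ℕ.* c) c) (cong (_* ι c) (trans (ι-* (c ℕ.* c) c) (cong (_* ι c) (ι-* c c))))

  ι-literal : ∀ k → (+ k / 1) ≡ ι k
  ι-literal k = normalize-coprime (coprime-sym (1-coprimeTo k))

  1/F*F : ∀ F .{{_ : ℕ.NonZero F}} → ((+ 1) / F) * ι F ≡ 1ℚ
  1/F*F (suc F′) = toℚᵘ-injective (ℚᵘ.≃-trans (toℚᵘ-homo-* (+ 1 / suc F′) (ι (suc F′)))
    (ℚᵘ.≃-trans (ℚᵘ.*-congʳ (toℚᵘ-fromℚᵘ (ℚᵘ.mkℚᵘ (+ 1) F′))) (ℚᵘ.*≡* eq)))
    where
    eq : (+ 1 ℤ.* + suc F′) ℤ.* + 1 ≡ + 1 ℤ.* + (suc F′ ℕ.* 1)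
    eq = trans (ℤ.*-identityʳ _) (trans (ℤ.*-identityˡ _)
           (trans (cong +_ (sym (ℕ.*-identityʳ (suc F′)))) (sym (ℤ.*-identityˡ _))))

  ratio*denominator : ∀ p q′ .(c : Coprime p (suc q′)) → mkℚ (+ p) q′ c * ι (suc q′) ≡ ι p
  ratio*denominator p q′ c = toℚᵘ-injective (ℚᵘ.≃-trans (toℚᵘ-homo-* (mkℚ (+ p) q′ c) (ι (suc q′))) (ℚᵘ.*≡* eq))
    where
    eq : (+ p ℤ.* + suc q′) ℤ.* + 1 ≡ + p ℤ.* + (suc q′ ℕ.* 1)
    eq = trans (ℤ.*-identityʳ _) (cong (+ p ℤ.*_) (cong +_ (sym (ℕ.*-identityʳ (suc q′)))))

  fraction-< : ∀ x F .{{_ : ℕ.NonZero F}} p q′ .(c : Coprime p (suc q′)) →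
               (+ x) / F < mkℚ (+ p) q′ c → x ℕ.* suc q′ ℕ.< p ℕ.* F
  fraction-< x (suc F′) p q′ c lt with ℚᵘ.<-respˡ-≃ (toℚᵘ-fromℚᵘ (ℚᵘ.mkℚᵘ (+ x) F′)) (toℚᵘ-mono-< lt)
  ... | ℚᵘ.*<* lt′ = ℤ.drop‿+<+ (subst₂ ℤ._<_ (sym (ℤ.pos-* x (suc q′))) (sym (ℤ.pos-* p (suc F′))) lt′)

  sumFin-cong : ∀ k {f g : Fin k → ℚ} → (∀ i → f i ≡ g i) → sumFin k f ≡ sumFin k g
  sumFin-cong zero    f≗g = refl
  sumFin-cong (suc k) f≗g = cong₂ _+_ (f≗g Fin.zero) (sumFin-cong k (λ i → f≗g (Fin.suc i)))

  sumFin-*ʳ : ∀ k (f : Fin k → ℚ) c → sumFin k f * c ≡ sumFin k (λ i → f i * c)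
  sumFin-*ʳ zero    f c = *-zeroˡ c
  sumFin-*ʳ (suc k) f c =
    trans (*-distribʳ-+ c (f Fin.zero) _) (cong (_+_ (f Fin.zero * c)) (sumFin-*ʳ k (λ i → f (Fin.suc i)) c))

  sumFin-ι : ∀ k (g : Fin k → ℕ) → sumFin k (λ i → ι (g i)) ≡ ι (Histories.sum g)
  sumFin-ι zero    g = refl
  sumFin-ι (suc k) g =
    trans (cong (_+_ (ι (g Fin.zero))) (sumFin-ι k (λ i → g (Fin.suc i)))) (sym (ι-+ (g Fin.zero) _))

  bit : Bool → ℕ
  bit true  = 1
  bit false = 0

  prob-histSum : ∀ n t P → prob n t P * ι (histories (faces t) n) ≡ ι (histSum n t (λ s → bit (P s)))
  prob-histSum zero t P with P t
  ... | true  = *-identityˡ (ι 1)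
  ... | false = *-zeroˡ (ι 1)
  prob-histSum (suc n) t P = begin
    (u * S) * ι (F ℕ.* histories (F ℕ.+ 2) n)      ≡⟨ cong ((u * S) *_) (ι-* F _) ⟩
    (u * S) * (ι F * ι (histories (F ℕ.+ 2) n))     ≡⟨ interchange u S _ _ ⟩
    (u * ι F) * (S * ι (histories (F ℕ.+ 2) n))     ≡⟨ cong (_* (S * ι (histories (F ℕ.+ 2) n))) (1/F*F F {{faces-nonZero t}}) ⟩
    1ℚ * (S * ι (histories (F ℕ.+ 2) n))            ≡⟨ *-identityˡ _ ⟩
    S * ι (histories (F ℕ.+ 2) n)                   ≡⟨ sumFin-*ʳ F _ _ ⟩
    sumFin F (λ i → prob n (subdivide t i) P * ι (histories (F ℕ.+ 2) n))
      ≡⟨ sumFin-cong F (λ i → trans (cong (λ G → prob n (subdivide t i) P * ι (histories G n))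
                                            (sym (faces-subdivide t i)))
                                      (prob-histSum n (subdivide t i) P)) ⟩
    sumFin F (λ i → ι (histSum n (subdivide t i) (λ s → bit (P s))))
      ≡⟨ sumFin-ι F _ ⟩
    ι (histSum (suc n) t (λ s → bit (P s))) ∎
    where
    open ≡-Reasoning
    F = faces t
    u = ((+ 1) / F) {{faces-nonZero t}}
    S = sumFin F (λ i → prob n (subdivide t i) P)
    interchange : ∀ u S v w → (u * S) * (v * w) ≡ (u * v) * (S * w)
    interchange u S v w = begin
      (u * S) * (v * w)  ≡⟨ *-assoc u S (v * w) ⟩
      u * (S * (v * w))  ≡⟨ cong (u *_) (trans (sym (*-assoc S v w)) (cong (_* w) (*-comm S v))) ⟩
      u * ((v * S) * w)  ≡⟨ cong (u *_) (*-assoc v S w) ⟩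
      u * (v * (S * w))  ≡⟨ sym (*-assoc u v (S * w)) ⟩
      (u * v) * (S * w)  ∎

  -- the first step of a RAN is forced
  ranProb-first-step : ∀ n P → ranProb (suc n) P ≡ prob n ChildDecomposition.ran₁ P
  ranProb-first-step n P =
    trans (cong (_* (prob n ChildDecomposition.ran₁ P + 0ℚ)) (trans (sym (*-identityʳ _)) (1/F*F 1)))
          (trans (*-identityˡ _) (+-identityʳ _))

  does-true : ∀ {A : Set} (d : Dec A) → does d ≡ true → A
  does-true (yes a) _  = a
  does-true (no  _) ()

  smallEvent-true : ∀ p q′ .(c : Coprime p (suc q′)) t →
                    smallEvent (mkℚ (+ p) q′ c) t ≡ true → minZ t ℕ.* suc q′ ℕ.< p ℕ.* faces t
  smallEvent-true p q′ c t holds = fraction-< (minZ t) (faces t) {{faces-nonZero t}} p q′ c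
    (does-true (((+ minZ t) / faces t) {{faces-nonZero t}} <? mkℚ (+ p) q′ c) holds)

  fourth-power-transfer : ∀ P c N p q′ .(cop : Coprime p (suc q′)) → P * ι N ≡ ι c →
    suc q′ ℕ.* (c ℕ.* c ℕ.* c ℕ.* c) ℕ.< 28561 ℕ.* p ℕ.* (N ℕ.* N ℕ.* N ℕ.* N) →
    P * P * P * P < (+ 28561 / 1) * mkℚ (+ p) q′ cop
  fourth-power-transfer P c N p q′ cop P*N≡c counted =
    *-cancelʳ-<-nonNeg (ι (q ℕ.* N⁴)) (subst₂ _<_ left right (ι-< _ _ counted))
    where
    open ≡-Reasoning
    open import Data.Rational.Solver using (module +-*-Solver)
    open +-*-Solver using (_:*_; _:=_; solve)
    q = suc q′
    ε = mkℚ (+ p) q′ cop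
    N⁴ = N ℕ.* N ℕ.* N ℕ.* N
    pull-P : ∀ q P N → q * ((P * N) * (P * N) * (P * N) * (P * N)) ≡ (P * P * P * P) * (q * (N * N * N * N))
    pull-P = solve 3 (λ q P N → q :* ((P :* N) :* (P :* N) :* (P :* N) :* (P :* N))
                              := (P :* P :* P :* P) :* (q :* (N :* N :* N :* N))) refl
    pull-ε : ∀ C ε q N → C * (ε * q) * (N * N * N * N) ≡ (C * ε) * (q * (N * N * N * N))
    pull-ε = solve 4 (λ C ε q N → C :* (ε :* q) :* (N :* N :* N :* N) := (C :* ε) :* (q :* (N :* N :* N :* N))) refl
    ι-q*N⁴ : ι (q ℕ.* N⁴) ≡ ι q * (ι N * ι N * ι N * ι N)
    ι-q*N⁴ = trans (ι-* q N⁴) (cong (ι q *_) (ι-fourth N))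
    left : ι (q ℕ.* (c ℕ.* c ℕ.* c ℕ.* c)) ≡ (P * P * P * P) * ι (q ℕ.* N⁴)
    left = begin
      ι (q ℕ.* (c ℕ.* c ℕ.* c ℕ.* c))                              ≡⟨ trans (ι-* q _) (cong (ι q *_) (ι-fourth c)) ⟩
      ι q * (ι c * ι c * ι c * ι c)                                ≡⟨ cong (λ x → ι q * (x * x * x * x)) (sym P*N≡c) ⟩
      ι q * ((P * ι N) * (P * ι N) * (P * ι N) * (P * ι N))        ≡⟨ pull-P (ι q) P (ι N) ⟩
      (P * P * P * P) * (ι q * (ι N * ι N * ι N * ι N))            ≡⟨ cong ((P * P * P * P) *_) (sym ι-q*N⁴) ⟩
      (P * P * P * P) * ι (q ℕ.* N⁴) ∎
    right : ι (28561 ℕ.* p ℕ.* N⁴) ≡ ((+ 28561 / 1) * ε) * ι (q ℕ.* N⁴)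
    right = begin
      ι (28561 ℕ.* p ℕ.* N⁴)                                       ≡⟨ trans (ι-* (28561 ℕ.* p) N⁴) (cong₂ _*_ (ι-* 28561 p) (ι-fourth N)) ⟩
      ι 28561 * ι p * (ι N * ι N * ι N * ι N)                      ≡⟨ cong (λ x → ι 28561 * x * (ι N * ι N * ι N * ι N)) (sym (ratio*denominator p q′ cop)) ⟩
      ι 28561 * (ε * ι q) * (ι N * ι N * ι N * ι N)                ≡⟨ pull-ε (ι 28561) ε (ι q) (ι N) ⟩
      (ι 28561 * ε) * (ι q * (ι N * ι N * ι N * ι N))              ≡⟨ cong₂ (λ C x → (C * ε) * x) (sym (ι-literal 28561)) (sym ι-q*N⁴) ⟩
      ((+ 28561 / 1) * ε) * ι (q ℕ.* N⁴) ∎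

module CountingForm where

  open Histories using (histSum; histories)
  open ChildDecomposition using (ran₁)
  open Covering using (module Events)
  open EventBounds using (module Estimates)
  open RationalCounting using (bit; smallEvent-true)
  open import Data.Nat using (ℕ; suc; _+_; _*_; _≤_; _<_; z≤n; s≤s; NonZero)
  open import Data.Nat.Properties using (≤-trans; m≤m+n; m≤n+m)
  open import Data.Integer using (+_)
  open import Data.Rational using (mkℚ)
  open import Data.Nat.Coprimality using (Coprime)
  open import Data.Bool using (true; false)
  open import Relation.Binary.PropositionalEquality

  threshold : ℕ → ℕ → ℕ
  threshold a q = 4 + 10 * q + (10 * a + 5) * q

  small-event-count : ∀ p q′ .(cop : Coprime p (suc q′)) a .{{_ : NonZero p}} .{{_ : NonZero a}} →
    p * suc q′ ≤ a * a → a * a ≤ 4 * (p * suc q′) → ∀ n → threshold a (suc q′) ≤ n →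
    let c = histSum n ran₁ (λ t → bit (smallEvent (mkℚ (+ p) q′ cop) t))
        N = histories 3 n
    in suc q′ * (c * c * c * c) < 28561 * p * (N * N * N * N)
  small-event-count p q′ cop a pq≤a² a²≤4pq n n-large =
    events-bound pq≤a² a²≤4pq (λ t → bit (smallEvent ε t)) dominated
    where
    q = suc q′
    ε = mkℚ (+ p) q′ cop
    open Estimates p q a n (≤-trans (m≤m+n _ _) n-large) (≤-trans (m≤n+m _ _) n-large)
    dominated : ∀ t → faces t ≡ M → bit (smallEvent ε t) ≤ events t
    dominated t faces≡M with smallEvent ε t in holds
    ... | true  = covering (s≤s z≤n) q<M t faces≡M
                    (subst (λ F → minZ t * q < p * F) faces≡M (smallEvent-true p q′ cop t holds))
    ... | false = z≤n

open Histories using (histories)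
open ChildDecomposition using (ran₁)
open SquareBounds using (square-window)
open RationalCounting using (prob-histSum; ranProb-first-step; fourth-power-transfer)
open CountingForm using (threshold; small-event-count)

open import Data.Nat as ℕ using (ℕ; suc)
open import Data.Product using (∃-syntax; _,_; proj₁; proj₂)
open import Data.Rational using (ℚ; 0ℚ; _<_; _*_)
import Data.Rational as Q
open import Data.Integer using (+_; -[1+_]; +<+)
open import Data.Nat.Properties using (≤-trans; ≤-pred; *-suc; +-cancelˡ-≤; *-cancelˡ-≤; m*n≢0⇒m≢0)
open import Relation.Binary.PropositionalEquality using (subst; sym)

-- Write ε = p/q and pick a with  pq ≤ a² ≤ 4pq.  The first
-- step of the RAN is forced; past the threshold of CountingForm the
-- count inequality  q c⁴ < 28561 p N⁴  becomes  P⁴ < 13⁴ ε.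
corollary5 : (ε : ℚ) → 0ℚ < ε →
    ∃[ m₀ ] ((n : ℕ) → m₀ ℕ.< suc (2 ℕ.* n) →
    let p = ranProb n (smallEvent ε) in
    p * p * p * p < (+ 28561 Q./ 1) * ε)
corollary5 (Q.mkℚ (+ ℕ.zero) _ _) (Q.*<* (+<+ ()))
corollary5 (Q.mkℚ -[1+ _ ] _ _) (Q.*<* ())
corollary5 ε@(Q.mkℚ (+ suc p′) q′ cop) _ = 2 ℕ.+ 2 ℕ.* L , bound
  where
  -- the auxiliary a ≈ √(pq)
  window = square-window (q′ ℕ.+ p′ ℕ.* suc q′)
  a : ℕ
  a = proj₁ window
  pq≤a² : suc p′ ℕ.* suc q′ ℕ.≤ a ℕ.* a
  pq≤a² = proj₁ (proj₂ window)
  a²≤4pq : a ℕ.* a ℕ.≤ 4 ℕ.* (suc p′ ℕ.* suc q′)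
  a²≤4pq = proj₂ (proj₂ window)
  instance
    a-nonZero : ℕ.NonZero a
    a-nonZero = m*n≢0⇒m≢0 a {{ℕ.>-nonZero (≤-trans (ℕ.s≤s ℕ.z≤n) pq≤a²)}}
  L : ℕ
  L = threshold a (suc q′)
  bound : (n : ℕ) → 2 ℕ.+ 2 ℕ.* L ℕ.< suc (2 ℕ.* n) →
          let p = ranProb n (smallEvent ε) in p * p * p * p < (+ 28561 Q./ 1) * ε
  bound ℕ.zero    (ℕ.s≤s ())
  bound (suc n′) past = subst (λ P → P * P * P * P < (+ 28561 Q./ 1) * ε) (sym (ranProb-first-step n′ (smallEvent ε)))
    (fourth-power-transfer (prob n′ ran₁ (smallEvent ε)) _ (histories 3 n′) (suc p′) q′ cop
      (prob-histSum n′ ran₁ (smallEvent ε))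
      (small-event-count (suc p′) q′ cop a pq≤a² a²≤4pq n′ L≤n′))
    where
    L≤n′ : L ℕ.≤ n′
    L≤n′ = *-cancelˡ-≤ 2 (+-cancelˡ-≤ 2 _ _ (subst (2 ℕ.+ 2 ℕ.* L ℕ.≤_) (*-suc 2 n′) (≤-pred past)))
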